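{- Let $m\ge2$ and let $G$ be a connected $m$-uniform hypergraph with cut vertices. If $G$ has $s\ge 2$ blocks $G_1,\dots,G_s$, then $s(G)=\prod_{i=1}^s s(G_i)$.
   Context: An $m$-uniform hypergraph $G=(V,E)$ has a finite vertex set $V=\{v_1,\dots,v_n\}$ and an edge set $E$ of $m$-element subsets of $V$; it is connected if any two vertices are joined by a walk $v_0e_1v_1\dots e_tv_t$ ($v_{i-1}\ne v_i$, $\{v_{i-1},v_i\}\subseteq e_i$). For vertex-disjoint nontrivial (more than one vertex) connected hypergraphs $H_1,H_2$ and vertices $w_1\in V(H_1)$, $w_2\in V(H_2)$, the coalescence $H_1(u)\odot H_2(u)$ is obtained by identifying $w_1$ and $w_2$ into a new vertex $u$; a vertex $u$ of $G$ is a cut vertex if $G$ is such a coalescence at $u$. A block of $G$ is an edge-maximal connected sub-hypergraph of $G$ without cut vertices. The adjacency tensor $\mathcal{A}(G)=(a_{i_1\dots i_m})$ is the order-$m$, dimension-$n$ tensor with $a_{i_1\dots i_m}=\frac{1}{(m-1)!}$ if $\{v_{i_1},\dots,v_{i_m}\}\in E$ and $0$ otherwise. For an order-$m$, dimension-$n$ tensor $\mathcal{A}$, $s(\mathcal{A})$ is the cardinality of the set of invertible complex diagonal matrices $D=\mathrm{diag}(d_1,\dots,d_n)$ with $d_1=1$ such that $d_{i_1}^{ -(m-1)}a_{i_1\dots i_m}d_{i_2}\cdots d_{i_m}=a_{i_1\dots i_m}$ for all $i_1,\dots,i_m\in[n]$. The stabilizing index of a hypergraph $H$ is $s(H):=s(\mathcal{A}(H))$.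 -}

module Defs where

open import Level using (Level; _⊔_; suc)
open import Data.Nat as ℕ using (ℕ; zero; suc; _∸_; _!; NonZero)
open import Data.Nat.Properties using (_!≢0)
open import Data.Bool using (Bool; true; false; if_then_else_; _∧_; T)
open import Data.Bool.Properties using () renaming (_≟_ to _≟ᵇ_)
open import Data.Fin as Fin using (Fin)
open import Data.Fin.Subset using (Subset; _∈_; _⊆_; _∪_; _∩_; ⁅_⁆; ∣_∣; ⊤)
open import Data.Vec as Vec using (Vec; lookup)
open import Data.Vec.Properties using (≡-dec)
open import Data.Vec.Relation.Unary.All using (All)
open import Data.List as List using (List; [_]; []; _∷_; _++_; allFin)
open import Data.Bool.ListAction using (any)
open import Data.Product using (Σ; ∃; ∃-syntax; _×_; _,_)
open import Data.Sum using (_⊎_)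
open import Relation.Nullary using (¬_)
open import Relation.Nullary.Decidable using (⌊_⌋)
open import Relation.Binary.PropositionalEquality as ≡ using (_≡_; _≢_)
open import Relation.Binary.Bundles using (Setoid)
open import Algebra.Bundles using (CommutativeRing)
open import Function.Bundles using (Inverse)
open import Function.Definitions using (Injective)

module _ {c ℓ : Level} (R : CommutativeRing c ℓ) where
  open CommutativeRing R

  fromℕ : ℕ → Carrier
  fromℕ zero    = 0#
  fromℕ (suc k) = 1# + fromℕ k

  -- polynomial evaluation, coefficients listed from the constant term up
  evalPoly : List Carrier → Carrier → Carrier
  evalPoly []       x = 0#
  evalPoly (a ∷ as) x = a + x * evalPoly as x

record ACField (c ℓ : Level) : Set (Level.suc (c ⊔ ℓ)) where
  field
    cring : CommutativeRing c ℓ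
  open CommutativeRing cring public hiding (ring)
  field
    nontrivial  : ¬ (1# ≈ 0#)
    inv         : (x : Carrier) → ¬ (x ≈ 0#) → Carrier
    inv-correct : (x : Carrier) (p : ¬ (x ≈ 0#)) → x * inv x p ≈ 1#
    char0       : (k : ℕ) → .{{NonZero k}} → ¬ (fromℕ cring k ≈ 0#)
    -- algebraically closed: every monic polynomial of degree ≥ 1 has a root
    algClosed   : (a : Carrier) (as : List Carrier) →
                  ∃[ x ] (evalPoly cring ((a ∷ as) ++ [ 1# ]) x ≈ 0#)

record Hypergraph (m : ℕ) : Set where
  field
    n       : ℕ
    k       : ℕ
    E       : Fin k → Subset n
    E-inj   : Injective _≡_ _≡_ E
    uniform : (j : Fin k) → ∣ E j ∣ ≡ m

module _ {m : ℕ} (G : Hypergraph m) where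
  open Hypergraph G

  -- A candidate sub-hypergraph: a vertex set and a set of edges of G.
  record Sub : Set where
    constructor sub
    field
      verts : Subset n
      edgs  : Subset k
  open Sub public

  whole : Sub
  whole = sub ⊤ ⊤

  IsSub : Sub → Set
  IsSub X = (j : Fin k) → j ∈ edgs X → E j ⊆ verts X

  data Walk (P : Fin k → Set) : Fin n → Fin n → Set where
    stop : ∀ x → Walk P x x
    step : ∀ {x z y} (j : Fin k) → P j → x ∈ E j → z ∈ E j → x ≢ z →
           Walk P z y → Walk P x y

  Connected′ : Subset n → (Fin k → Set) → Set
  Connected′ W P = ∀ x y → x ∈ W → y ∈ W → Walk P x y

  Connected : Sub → Set
  Connected X = Connected′ (verts X) (λ j → j ∈ edgs X)

  -- u is a cut vertex of X: X is the coalescence at u of two nontrivial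
  -- connected hypergraphs, i.e. of its sub-hypergraphs on vertex sets
  -- V₁, V₂ with V₁ ∪ V₂ = W, V₁ ∩ V₂ = {u}, each carrying the edges of X
  -- inside it, every edge of X lying in V₁ or in V₂.
  IsCutVertex : Sub → Fin n → Set
  IsCutVertex X u = u ∈ verts X × ∃[ V₁ ] ∃[ V₂ ]
    ( (V₁ ∪ V₂ ≡ verts X)
    × (V₁ ∩ V₂ ≡ ⁅ u ⁆)
    × (2 ℕ.≤ ∣ V₁ ∣) × (2 ℕ.≤ ∣ V₂ ∣)
    × ((j : Fin k) → j ∈ edgs X → (E j ⊆ V₁) ⊎ (E j ⊆ V₂))
    × Connected′ V₁ (λ j → j ∈ edgs X × E j ⊆ V₁)
    × Connected′ V₂ (λ j → j ∈ edgs X × E j ⊆ V₂) )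

  HasCutVertex : Sub → Set
  HasCutVertex X = ∃[ u ] IsCutVertex X u

  NoCutVertex : Sub → Set
  NoCutVertex X = ∀ u → ¬ IsCutVertex X u

  IsBlock : Sub → Set
  IsBlock X = IsSub X × Connected X × NoCutVertex X ×
    ((Y : Sub) → IsSub Y → Connected Y → NoCutVertex Y →
      verts X ⊆ verts Y → edgs X ⊆ edgs Y → edgs Y ⊆ edgs X)

  entrySet : Fin n → Vec (Fin n) (m ∸ 1) → Subset n
  entrySet i is = Vec.foldr (λ _ → Subset n) (λ v S → ⁅ v ⁆ ∪ S) ⁅ i ⁆ is

  isEdge : Sub → Subset n → Bool
  isEdge X S = any (λ j → lookup (edgs X) j ∧ ⌊ ≡-dec _≟ᵇ_ (E j) S ⌋)
                        (allFin k)

  module _ {c ℓ : Level} (K : ACField c ℓ) where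
    open ACField K

    -- adjacency tensor of the sub-hypergraph X, an order-m tensor whose
    -- entry a_{i₁ i₂ … i_m} is written  adj X i₁ (i₂ ∷ … ∷ i_m ∷ [])
    adj : Sub → Fin n → Vec (Fin n) (m ∸ 1) → Carrier
    adj X i is = if isEdge X (entrySet i is)
                 then inv (fromℕ cring ((m ∸ 1) !)) (char0 ((m ∸ 1) !) {{(m ∸ 1) !≢0}})
                 else 0#

    pow : Carrier → ℕ → Carrier
    pow x zero    = 1#
    pow x (suc e) = x * pow x e

    prodV : ∀ {t} → Vec Carrier t → Carrier
    prodV = Vec.foldr (λ _ → Carrier) _*_ 1#

    -- invertible diagonal matrices D = diag(d_v : v ∈ verts X), normalised
    -- by d = 1 at the first (least) vertex of X, with
    -- d_{i₁}^{-(m-1)} a_{i₁…i_m} d_{i₂} ⋯ d_{i_m} = a_{i₁…i_m}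
    record Stab (X : Sub) : Set (c ⊔ ℓ) where
      field
        d       : Fin n → Carrier
        nonzero : (i : Fin n) → i ∈ verts X → ¬ (d i ≈ 0#)
        first   : (i : Fin n) → i ∈ verts X →
                  ((j : Fin n) → j ∈ verts X → i Fin.≤ j) → d i ≈ 1#
        stab    : (i : Fin n) (iX : i ∈ verts X)
                  (is : Vec (Fin n) (m ∸ 1)) → All (_∈ verts X) is →
                  pow (inv (d i) (nonzero i iX)) (m ∸ 1) * adj X i is
                    * prodV (Vec.map d is)
                  ≈ adj X i is
    open Stab public

    StabSetoid : Sub → Setoid (c ⊔ ℓ) ℓ
    StabSetoid X = record
      { Carrier = Stab X
      ; _≈_ = λ D D′ → (i : Fin n) → i ∈ verts X → d D i ≈ d D′ i
      ; isEquivalence = record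
        { refl  = λ i _ → refl
        ; sym   = λ p i iX → sym (p i iX)
        ; trans = λ p q i iX → trans (p i iX) (q i iX) } }

    -- s(X) = c : the set above has exactly c elements
    HasStabIndex : Sub → ℕ → Set (c ⊔ ℓ)
    HasStabIndex X s = Inverse (≡.setoid (Fin s)) (StabSetoid X)

∏ : ∀ {s} → (Fin s → ℕ) → ℕ
∏ {zero}  f = 1
∏ {suc s} f = f Fin.zero ℕ.* ∏ (λ i → f (Fin.suc i))

-- Restricting a stabilising diagonal matrix of G to a block and rescaling it to be 1 at the
-- block's least vertex gives one of the block.  Conversely, the blocks form a tree: they can be
-- listed so that each meets the union of the earlier ones in exactly one vertex, since a block
-- meeting a connected union of other blocks twice would contradict its maximality.  Gluing
-- matrices of the blocks along this list, rescaling each new one to agree with the earlier ones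
-- at its attaching vertex, inverts the restriction, because every nonzero entry of the adjacency
-- tensor of G comes from an edge, and every edge lies in a block.

module Submission where

open import Defs
open import Level using (Level; 0ℓ)
open import Data.Nat as ℕ using (ℕ; zero; suc; _≤_; _<_; _∸_; z≤n; s≤s)
import Data.Nat.Properties as ℕₚ
open import Data.Bool using (true; false; if_then_else_)
open import Data.Fin as Fin using (Fin; _≟_)
import Data.Fin.Properties as Finₚ
open import Data.Fin.Subset hiding (⋃)
open import Data.Fin.Subset.Properties
open import Data.Vec as Vec using (Vec; []; _∷_; here; there)
import Data.Vec.Properties as Vecₚ
open import Data.Vec.Relation.Unary.All as All using (All; []; _∷_)
open import Data.List using (allFin)
import Data.List.Relation.Unary.Any as Any
import Data.List.Relation.Unary.Any.Properties as Anyₚ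
import Data.List.Membership.Propositional as List
import Data.List.Membership.Propositional.Properties as Listₚ
import Data.Bool.Properties as Boolₚ
open import Data.Product using (∃; ∃-syntax; _×_; _,_; proj₁; proj₂)
open import Data.Sum using (_⊎_; inj₁; inj₂; [_,_])
open import Data.Empty as Empty using (⊥-elim)
open import Relation.Nullary using (¬_; Dec; yes; no; ¬?; contradiction)
open import Relation.Nullary.Decidable using (⌊_⌋; _×-dec_; _→-dec_; decidable-stable; toWitness; fromWitness)
open import Relation.Unary using (Pred; Decidable)
open import Relation.Binary.PropositionalEquality as ≡
  using (_≡_; _≢_; refl; sym; trans; cong; cong₂; subst)
open import Function using (_∘_; _$_; case_of_)
open import Function.Definitions using (Injective)
open import Function.Bundles using (Equivalence; Inverse)
import Function.Construct.Composition as Composition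
open import Relation.Binary.Bundles using (Setoid)

-- Finite sets

subsetOf : ∀ {n} {P : Pred (Fin n) 0ℓ} → Decidable P → Subset n
subsetOf {zero}  P? = []
subsetOf {suc n} P? = ⌊ P? Fin.zero ⌋ ∷ subsetOf (P? ∘ Fin.suc)

∈subsetOf⁻ : ∀ {n} {P : Pred (Fin n) 0ℓ} (P? : Decidable P) {x} → x ∈ subsetOf P? → P x
∈subsetOf⁻ P? {Fin.zero} x∈ with P? Fin.zero
... | yes p = p
... | no _  = case x∈ of λ ()
∈subsetOf⁻ P? {Fin.suc x} (there x∈) = ∈subsetOf⁻ (P? ∘ Fin.suc) x∈

∈subsetOf⁺ : ∀ {n} {P : Pred (Fin n) 0ℓ} (P? : Decidable P) {x} → P x → x ∈ subsetOf P?
∈subsetOf⁺ P? {Fin.zero} p with P? Fin.zero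
... | yes _ = here
... | no ¬p = contradiction p ¬p
∈subsetOf⁺ P? {Fin.suc x} p = there (∈subsetOf⁺ (P? ∘ Fin.suc) p)

IsLeast : ∀ {n} → Subset n → Fin n → Set
IsLeast p f = f ∈ p × ((j : Fin _) → j ∈ p → f Fin.≤ j)

least : ∀ {n} {p : Subset n} {x} → x ∈ p → ∃ (IsLeast p)
least {p = true ∷ p} _ = Fin.zero , here , λ _ _ → z≤n
least {p = false ∷ p} (there x∈p) with least x∈p
... | f , f∈p , f≤ = Fin.suc f , there f∈p , λ { Fin.zero () ; (Fin.suc j) (there j∈p) → s≤s (f≤ j j∈p) }

least-unique : ∀ {n} {p : Subset n} {f g} → IsLeast p f → IsLeast p g → f ≡ g
least-unique (f∈p , f≤) (g∈p , g≤) = Finₚ.≤-antisym (f≤ _ g∈p) (g≤ _ f∈p)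

¬∀∈⇒∃∈¬ : ∀ {n} {P : Pred (Fin n) 0ℓ} → Decidable P → (p : Subset n) →
          ¬ (∀ x → x ∈ p → P x) → ∃[ x ] (x ∈ p × ¬ P x)
¬∀∈⇒∃∈¬ P? p ¬∀ with Finₚ.any? (λ x → x ∈? p ×-dec ¬? (P? x))
... | yes found = found
... | no none = ⊥-elim (¬∀ λ x x∈p → decidable-stable (P? x) (λ ¬Px → none (x , x∈p , ¬Px)))

⊈⇒∃ : ∀ {n} {p q : Subset n} → ¬ p ⊆ q → ∃[ x ] (x ∈ p × x ∉ q)
⊈⇒∃ {p = p} {q} p⊈q = ¬∀∈⇒∃∈¬ (_∈? q) p (λ p⊆q → p⊈q (p⊆q _))

2≤∣p∣⇒p⊈⁅u⁆ : ∀ {n} {p : Subset n} {u} → 2 ≤ ∣ p ∣ → ¬ p ⊆ ⁅ u ⁆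
2≤∣p∣⇒p⊈⁅u⁆ {u = u} 2≤∣p∣ p⊆⁅u⁆ =
  ℕₚ.<⇒≱ 2≤∣p∣ (ℕₚ.≤-trans (p⊆q⇒∣p∣≤∣q∣ p⊆⁅u⁆) (ℕₚ.≤-reflexive (∣⁅x⁆∣≡1 u)))

∃∈-≢ : ∀ {n} {p : Subset n} {u} → 2 ≤ ∣ p ∣ → ∃[ x ] (x ∈ p × x ≢ u)
∃∈-≢ {p = p} {u} 2≤∣p∣ with ⊈⇒∃ (2≤∣p∣⇒p⊈⁅u⁆ {u = u} 2≤∣p∣)
... | x , x∈p , x∉⁅u⁆ = x , x∈p , x∉⁅y⁆⇒x≢y x∉⁅u⁆

∃-two : ∀ {n} {p : Subset n} → 2 ≤ ∣ p ∣ → ∃[ a ] ∃[ b ] (a ≢ b × a ∈ p × b ∈ p)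
∃-two {n} {p} 2≤∣p∣ with nonempty? p
... | no ¬ne = contradiction (trans (cong ∣_∣ (Empty-unique ¬ne)) (∣⊥∣≡0 n)) (ℕₚ.>⇒≢ (ℕₚ.<-trans (s≤s z≤n) 2≤∣p∣))
... | yes (a , a∈p) with ∃∈-≢ {u = a} 2≤∣p∣
...   | b , b∈p , b≢a = a , b , b≢a ∘ sym , a∈p , b∈p

≤-fuel-step : ∀ {t N a b} → t ≤ suc N ℕ.+ a → a < b → t ≤ N ℕ.+ b
≤-fuel-step {N = N} t≤ a<b = ℕₚ.≤-trans t≤ (ℕₚ.≤-trans (ℕₚ.≤-reflexive (sym (ℕₚ.+-suc N _))) (ℕₚ.+-monoʳ-≤ N a<b))

-- Separations and walks

record Separation {n} (u : Fin n) : Set where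
  constructor separation
  field
    V₁ V₂     : Subset n
    V₁∩V₂≡⁅u⁆ : V₁ ∩ V₂ ≡ ⁅ u ⁆

  meet : ∀ {v} → v ∈ V₁ → v ∈ V₂ → v ≡ u
  meet v∈V₁ v∈V₂ = x∈⁅y⁆⇒x≡y u (subst (_ ∈_) V₁∩V₂≡⁅u⁆ (x∈p∩q⁺ (v∈V₁ , v∈V₂)))

  u∈V₁∩V₂ : u ∈ V₁ × u ∈ V₂
  u∈V₁∩V₂ = x∈p∩q⁻ V₁ V₂ (subst (u ∈_) (sym V₁∩V₂≡⁅u⁆) (x∈⁅x⁆ u))

  V₁∪V₂≡W⇒W⊈V₁ : ∀ {W} → V₁ ∪ V₂ ≡ W → 2 ≤ ∣ V₂ ∣ → ¬ W ⊆ V₁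
  V₁∪V₂≡W⇒W⊈V₁ V₁∪V₂≡W 2≤∣V₂∣ W⊆V₁ = 2≤∣p∣⇒p⊈⁅u⁆ 2≤∣V₂∣ λ {v} v∈V₂ →
    subst (v ∈_) V₁∩V₂≡⁅u⁆ (x∈p∩q⁺ (W⊆V₁ (subst (v ∈_) V₁∪V₂≡W (x∈p∪q⁺ (inj₂ v∈V₂))) , v∈V₂))

  W∩V₁∪W∩V₂≡W : ∀ {W} → W ⊆ V₁ ∪ V₂ → (W ∩ V₁) ∪ (W ∩ V₂) ≡ W
  W∩V₁∪W∩V₂≡W {W} W⊆V₁∪V₂ = ⊆-antisym
    (λ v∈ → [ proj₁ ∘ x∈p∩q⁻ W V₁ , proj₁ ∘ x∈p∩q⁻ W V₂ ] (x∈p∪q⁻ _ _ v∈))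
    (λ v∈W → x∈p∪q⁺ (Data.Sum.map (λ v∈V₁ → x∈p∩q⁺ (v∈W , v∈V₁)) (λ v∈V₂ → x∈p∩q⁺ (v∈W , v∈V₂))
                                  (x∈p∪q⁻ V₁ V₂ (W⊆V₁∪V₂ v∈W))))

  W∩V₁∩W∩V₂≡⁅u⁆ : ∀ {W} → u ∈ W → (W ∩ V₁) ∩ (W ∩ V₂) ≡ ⁅ u ⁆
  W∩V₁∩W∩V₂≡⁅u⁆ {W} u∈W = ⊆-antisym
    (λ v∈ → case x∈p∩q⁻ _ _ v∈ of λ { (v∈₁ , v∈₂) →
       subst (_∈ ⁅ u ⁆) (sym (meet (proj₂ (x∈p∩q⁻ W V₁ v∈₁)) (proj₂ (x∈p∩q⁻ W V₂ v∈₂)))) (x∈⁅x⁆ u) })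
    (λ v∈⁅u⁆ → subst (_∈ (W ∩ V₁) ∩ (W ∩ V₂)) (sym (x∈⁅y⁆⇒x≡y u v∈⁅u⁆))
       (x∈p∩q⁺ (x∈p∩q⁺ (u∈W , proj₁ u∈V₁∩V₂) , x∈p∩q⁺ (u∈W , proj₂ u∈V₁∩V₂))))

swap : ∀ {n} {u : Fin n} → Separation u → Separation u
swap (separation V₁ V₂ V₁∩V₂≡⁅u⁆) = separation V₂ V₁ (trans (∩-comm V₂ V₁) V₁∩V₂≡⁅u⁆)

Splits : ∀ {m} (G : Hypergraph m) {u : Fin (Hypergraph.n G)} → Separation u →
         Pred (Fin (Hypergraph.k G)) 0ℓ → Set
Splits G S P = ∀ j → P j → E j ⊆ Separation.V₁ S ⊎ E j ⊆ Separation.V₂ S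
  where open Hypergraph G

module _ {m} {G : Hypergraph m} where
  open Hypergraph G

  Walk-map : ∀ {P Q : Pred (Fin k) 0ℓ} → (∀ j → P j → Q j) → ∀ {x y} → Walk G P x y → Walk G Q x y
  Walk-map f (stop x)              = stop x
  Walk-map f (step j pj x∈ z∈ x≢z w) = step j (f j pj) x∈ z∈ x≢z (Walk-map f w)

  _++ʷ_ : ∀ {P x y z} → Walk G P x y → Walk G P y z → Walk G P x z
  stop x                  ++ʷ w′ = w′
  step j pj x∈ z∈ x≢z w ++ʷ w′ = step j pj x∈ z∈ x≢z (w ++ʷ w′)

  Walk-closed : ∀ {P} (A : Subset n) → (∀ j → P j → ∀ {v} → v ∈ E j → v ∈ A → E j ⊆ A) →
                ∀ {x y} → Walk G P x y → x ∈ A → y ∈ A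
  Walk-closed A closed (stop x)                x∈A = x∈A
  Walk-closed A closed (step j pj x∈ z∈ _ w) x∈A = Walk-closed A closed w (closed j pj x∈ x∈A z∈)

  Walk-first-edge : ∀ {P x y} → Walk G P x y → x ≢ y → ∃[ j ] (P j × x ∈ E j)
  Walk-first-edge (stop x)               x≢x = contradiction refl x≢x
  Walk-first-edge (step j pj x∈ _ _ _) _   = j , pj , x∈

  Connected′-∪ : ∀ {A C D : Subset n} {P Q R} → Connected′ G A P → Connected′ G C Q →
                 ∀ {z} → z ∈ A → z ∈ C → D ⊆ A ∪ C →
                 (∀ j → P j → R j) → (∀ j → Q j → R j) → Connected′ G D R
  Connected′-∪ cA cC {z} z∈A z∈C D⊆A∪C P⇒R Q⇒R x y x∈D y∈D
    with x∈p∪q⁻ _ _ (D⊆A∪C x∈D) | x∈p∪q⁻ _ _ (D⊆A∪C y∈D)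
  ... | inj₁ x∈A | inj₁ y∈A = Walk-map P⇒R (cA x y x∈A y∈A)
  ... | inj₁ x∈A | inj₂ y∈C = Walk-map P⇒R (cA x z x∈A z∈A) ++ʷ Walk-map Q⇒R (cC z y z∈C y∈C)
  ... | inj₂ x∈C | inj₁ y∈A = Walk-map Q⇒R (cC x z x∈C z∈C) ++ʷ Walk-map P⇒R (cA z y z∈A y∈A)
  ... | inj₂ x∈C | inj₂ y∈C = Walk-map Q⇒R (cC x y x∈C y∈C)

  Splits-swap : ∀ {u} {S : Separation u} {P} → Splits G S P → Splits G (swap S) P
  Splits-swap {S = separation _ _ _} split j pj = [ inj₂ , inj₁ ] (split j pj)

  module _ {P : Pred (Fin k) 0ℓ} {u : Fin n} (S : Separation u) (split : Splits G S P) where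
    open Separation S

    private
      OnV₁ : Pred (Fin k) 0ℓ
      OnV₁ j = P j × E j ⊆ V₁

      -- once a walk leaves V₁ it can only re-enter through u
      restrict : ∀ {x y} → Walk G P x y → y ∈ V₁ →
                 (x ∈ V₁ → Walk G OnV₁ x y) × (x ∉ V₁ → Walk G OnV₁ u y)
      restrict (stop x) y∈V₁ = (λ _ → stop x) , (λ x∉V₁ → contradiction y∈V₁ x∉V₁)
      restrict {x} (step {z = z} j pj x∈ z∈ x≢z w) y∈V₁ with restrict w y∈V₁ | split j pj
      ... | from-z , from-u | inj₁ j⊆V₁ =
        (λ _ → step j (pj , j⊆V₁) x∈ z∈ x≢z (from-z (j⊆V₁ z∈))) , (λ x∉V₁ → contradiction (j⊆V₁ x∈) x∉V₁)
      ... | from-z , from-u | inj₂ j⊆V₂ with z ∈? V₁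
      ...   | yes z∈V₁ = (λ x∈V₁ → contradiction (trans (meet x∈V₁ (j⊆V₂ x∈)) (sym (meet z∈V₁ (j⊆V₂ z∈)))) x≢z)
                       , (λ _ → subst (λ v → Walk G OnV₁ v _) (meet z∈V₁ (j⊆V₂ z∈)) (from-z z∈V₁))
      ...   | no z∉V₁  = (λ x∈V₁ → subst (λ v → Walk G OnV₁ v _) (sym (meet x∈V₁ (j⊆V₂ x∈))) (from-u z∉V₁))
                       , (λ _ → from-u z∉V₁)

    Walk-restrict : ∀ {x y} → Walk G P x y → x ∈ V₁ → y ∈ V₁ → Walk G (λ j → P j × E j ⊆ V₁) x y
    Walk-restrict w x∈V₁ y∈V₁ = proj₁ (restrict w y∈V₁) x∈V₁

    Walk-through-u : ∀ {x y} → Walk G P x y → x ∉ V₁ → y ∈ V₁ → Walk G (λ j → P j × E j ⊆ V₁) u y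
    Walk-through-u w x∉V₁ y∈V₁ = proj₂ (restrict w y∈V₁) x∉V₁

  module _ {X : Sub G} {u : Fin n} where

    separationOf : IsCutVertex G X u → Separation u
    separationOf (_ , V₁ , V₂ , _ , V₁∩V₂≡ , _) = separation V₁ V₂ V₁∩V₂≡

    splits : (cut : IsCutVertex G X u) → Splits G (separationOf cut) (_∈ edgs X)
    splits (_ , _ , _ , _ , _ , _ , _ , split , _) = split

    side₁-proper : (cut : IsCutVertex G X u) → ¬ verts X ⊆ Separation.V₁ (separationOf cut)
    side₁-proper cut@(_ , _ , _ , V₁∪V₂≡ , _ , _ , 2≤∣V₂∣ , _) =
      Separation.V₁∪V₂≡W⇒W⊈V₁ (separationOf cut) V₁∪V₂≡ 2≤∣V₂∣

    side₂-proper : (cut : IsCutVertex G X u) → ¬ verts X ⊆ Separation.V₂ (separationOf cut)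
    side₂-proper cut@(_ , V₁ , V₂ , V₁∪V₂≡ , _ , 2≤∣V₁∣ , _) =
      Separation.V₁∪V₂≡W⇒W⊈V₁ (swap (separationOf cut)) (trans (∪-comm V₂ V₁) V₁∪V₂≡) 2≤∣V₁∣

-- Connected subhypergraphs without cut vertices

module CutFree {m} (2≤m : 2 ≤ m) (G : Hypergraph m) where
  open Hypergraph G

  2≤∣E∣ : ∀ j → 2 ≤ ∣ E j ∣
  2≤∣E∣ j = subst (2 ≤_) (sym (uniform j)) 2≤m

  ∃∈E-≢ : ∀ j u → ∃[ x ] (x ∈ E j × x ≢ u)
  ∃∈E-≢ j u = ∃∈-≢ (2≤∣E∣ j)

  ∃-two-in-E : ∀ j → ∃[ a ] ∃[ b ] (a ≢ b × a ∈ E j × b ∈ E j)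
  ∃-two-in-E j = ∃-two (2≤∣E∣ j)

  module _ {Z : Sub G} (sZ : IsSub G Z) (cZ : Connected G Z) where

    edge-at : Nonempty (edgs Z) → ∀ {v} → v ∈ verts Z → ∃[ j ] (j ∈ edgs Z × v ∈ E j)
    edge-at (j₀ , j₀∈Z) {v} v∈Z with ∃∈E-≢ j₀ v
    ... | x , x∈ , x≢v = Walk-first-edge (cZ v x v∈Z (sZ j₀ j₀∈Z x∈)) (x≢v ∘ sym)

    verts⊆ : Nonempty (edgs Z) → ∀ {A} → (∀ j → j ∈ edgs Z → E j ⊆ A) → verts Z ⊆ A
    verts⊆ ne edges⊆A v∈Z with edge-at ne v∈Z
    ... | j , j∈Z , v∈j = edges⊆A j j∈Z v∈j

    side-size : ∀ {j A} → j ∈ edgs Z → E j ⊆ A → 2 ≤ ∣ verts Z ∩ A ∣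
    side-size {j} j∈Z j⊆A = ℕₚ.≤-trans (2≤∣E∣ j) (p⊆q⇒∣p∣≤∣q∣ (λ v∈ → x∈p∩q⁺ (sZ j j∈Z v∈ , j⊆A v∈)))

    side-connected : ∀ {u} (S : Separation u) → Splits G S (_∈ edgs Z) →
      let W = verts Z ∩ Separation.V₁ S in Connected′ G W (λ j → j ∈ edgs Z × E j ⊆ W)
    side-connected S split x y x∈W y∈W = Walk-map
      (λ j (j∈Z , j⊆V₁) → j∈Z , λ v∈ → x∈p∩q⁺ (sZ j j∈Z v∈ , j⊆V₁ v∈))
      (Walk-restrict S split (cZ x y (proj₁ (x∈p∩q⁻ _ _ x∈W)) (proj₁ (x∈p∩q⁻ _ _ y∈W)))
                             (proj₂ (x∈p∩q⁻ _ _ x∈W)) (proj₂ (x∈p∩q⁻ _ _ y∈W)))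

    module _ {u : Fin n} (S : Separation u) (split : Splits G S (_∈ edgs Z)) where
      open Separation S

      -- a walk from the V₂-side of j₂ to the V₁-side of j₁ must pass through u
      u∈Z : ∀ {j₁ j₂} → j₁ ∈ edgs Z → E j₁ ⊆ V₁ → j₂ ∈ edgs Z → E j₂ ⊆ V₂ → u ∈ verts Z
      u∈Z {j₁} {j₂} j₁∈Z j₁⊆V₁ j₂∈Z j₂⊆V₂ with ∃∈E-≢ j₁ u | ∃∈E-≢ j₂ u
      ... | x₁ , x₁∈ , x₁≢u | x₂ , x₂∈ , x₂≢u
        with Walk-first-edge (Walk-through-u S split (cZ x₂ x₁ (sZ j₂ j₂∈Z x₂∈) (sZ j₁ j₁∈Z x₁∈))
                                (λ x₂∈V₁ → x₂≢u (meet x₂∈V₁ (j₂⊆V₂ x₂∈))) (j₁⊆V₁ x₁∈)) (x₁≢u ∘ sym)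
      ... | j , (j∈Z , _) , u∈j = sZ j j∈Z u∈j

      mixed-sides⇒cut-vertex : ∀ {j₁ j₂} → j₁ ∈ edgs Z → E j₁ ⊆ V₁ → j₂ ∈ edgs Z → E j₂ ⊆ V₂ →
                               IsCutVertex G Z u
      mixed-sides⇒cut-vertex j₁∈Z j₁⊆V₁ j₂∈Z j₂⊆V₂ =
        u∈Z j₁∈Z j₁⊆V₁ j₂∈Z j₂⊆V₂ , verts Z ∩ V₁ , verts Z ∩ V₂ ,
        W∩V₁∪W∩V₂≡W (verts⊆ (_ , j₁∈Z) λ j j∈Z v∈j →
          x∈p∪q⁺ (Data.Sum.map (λ j⊆ → j⊆ v∈j) (λ j⊆ → j⊆ v∈j) (split j j∈Z))) ,
        W∩V₁∩W∩V₂≡⁅u⁆ (u∈Z j₁∈Z j₁⊆V₁ j₂∈Z j₂⊆V₂) ,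
        side-size j₁∈Z j₁⊆V₁ , side-size j₂∈Z j₂⊆V₂ ,
        (λ j j∈Z → Data.Sum.map (λ j⊆ v∈ → x∈p∩q⁺ (sZ j j∈Z v∈ , j⊆ v∈))
                                (λ j⊆ v∈ → x∈p∩q⁺ (sZ j j∈Z v∈ , j⊆ v∈)) (split j j∈Z)) ,
        side-connected S split , side-connected (swap S) (Splits-swap {G = G} {S = S} split)

      ⊈V₂⇒⊆V₁ : ∀ {j} → j ∈ edgs Z → ¬ E j ⊆ V₂ → E j ⊆ V₁
      ⊈V₂⇒⊆V₁ {j} j∈Z j⊈V₂ with split j j∈Z
      ... | inj₁ j⊆V₁ = j⊆V₁
      ... | inj₂ j⊆V₂ = ⊥-elim (j⊈V₂ λ {v} → j⊆V₂ {v})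

      ⊈V₁⇒⊆V₂ : ∀ {j} → j ∈ edgs Z → ¬ E j ⊆ V₁ → E j ⊆ V₂
      ⊈V₁⇒⊆V₂ {j} j∈Z j⊈V₁ with split j j∈Z
      ... | inj₁ j⊆V₁ = ⊥-elim (j⊈V₁ λ {v} → j⊆V₁ {v})
      ... | inj₂ j⊆V₂ = j⊆V₂

      cut-free⇒edges-one-side : NoCutVertex G Z →
        (∀ j → j ∈ edgs Z → E j ⊆ V₁) ⊎ (∀ j → j ∈ edgs Z → E j ⊆ V₂)
      cut-free⇒edges-one-side nZ with all-in? V₁ | all-in? V₂
        where
        all-in? : ∀ A → Dec (∀ j → j ∈ edgs Z → E j ⊆ A)
        all-in? A = Finₚ.all? (λ j → j ∈? edgs Z →-dec E j ⊆? A)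
      ... | yes all⊆V₁ | _         = inj₁ all⊆V₁
      ... | no _       | yes all⊆V₂ = inj₂ all⊆V₂
      ... | no ¬all⊆V₁ | no ¬all⊆V₂
        with ¬∀∈⇒∃∈¬ (λ j → E j ⊆? V₁) (edgs Z) ¬all⊆V₁ | ¬∀∈⇒∃∈¬ (λ j → E j ⊆? V₂) (edgs Z) ¬all⊆V₂
      ... | j₂ , j₂∈Z , j₂⊈V₁ | j₁ , j₁∈Z , j₁⊈V₂ = ⊥-elim $ nZ u $ mixed-sides⇒cut-vertex
        j₁∈Z (⊈V₂⇒⊆V₁ j₁∈Z j₁⊈V₂) j₂∈Z (⊈V₁⇒⊆V₂ j₂∈Z j₂⊈V₁)

      cut-free⇒one-side : Nonempty (edgs Z) → NoCutVertex G Z → verts Z ⊆ V₁ ⊎ verts Z ⊆ V₂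
      cut-free⇒one-side ne nZ with cut-free⇒edges-one-side nZ
      ... | inj₁ edges⊆V₁ = inj₁ (verts⊆ ne edges⊆V₁)
      ... | inj₂ edges⊆V₂ = inj₂ (verts⊆ ne edges⊆V₂)

  two-vertices⇒edge : ∀ {Z : Sub G} → Connected G Z → ∀ {a b} → a ≢ b → a ∈ verts Z → b ∈ verts Z →
                      Nonempty (edgs Z)
  two-vertices⇒edge cZ a≢b a∈Z b∈Z with Walk-first-edge (cZ _ _ a∈Z b∈Z) a≢b
  ... | j , j∈Z , _ = j , j∈Z

  infixl 6 _⊔_
  _⊔_ : Sub G → Sub G → Sub G
  X ⊔ Y = sub (verts X ∪ verts Y) (edgs X ∪ edgs Y)

  ⊔-isSub : ∀ {X Y} → IsSub G X → IsSub G Y → IsSub G (X ⊔ Y)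
  ⊔-isSub {X} {Y} sX sY j j∈X⊔Y with x∈p∪q⁻ (edgs X) (edgs Y) j∈X⊔Y
  ... | inj₁ j∈X = λ v∈ → x∈p∪q⁺ (inj₁ (sX j j∈X v∈))
  ... | inj₂ j∈Y = λ v∈ → x∈p∪q⁺ (inj₂ (sY j j∈Y v∈))

  ⊔-connected : ∀ {X Y} → Connected G X → Connected G Y →
                ∀ {z} → z ∈ verts X → z ∈ verts Y → Connected G (X ⊔ Y)
  ⊔-connected cX cY z∈X z∈Y = Connected′-∪ cX cY z∈X z∈Y (λ v∈ → v∈)
    (λ _ j∈X → x∈p∪q⁺ (inj₁ j∈X)) (λ _ j∈Y → x∈p∪q⁺ (inj₂ j∈Y))

  -- both X and Y lie on one side of a separation of X ⊔ Y; they cannot share two vertices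
  -- if those sides differ, and cannot cover X ⊔ Y if they agree
  ⊔-noCutVertex : ∀ {X Y} → IsSub G X → Connected G X → NoCutVertex G X →
                  IsSub G Y → Connected G Y → NoCutVertex G Y →
                  ∀ {a b} → a ≢ b → a ∈ verts X → b ∈ verts X → a ∈ verts Y → b ∈ verts Y →
                  NoCutVertex G (X ⊔ Y)
  ⊔-noCutVertex {X} {Y} sX cX nX sY cY nY {a} {b} a≢b a∈X b∈X a∈Y b∈Y u cut =
    sides (cut-free⇒one-side sX cX S (λ j j∈X → splits cut j (x∈p∪q⁺ (inj₁ j∈X)))
             (two-vertices⇒edge cX a≢b a∈X b∈X) nX)
          (cut-free⇒one-side sY cY S (λ j j∈Y → splits cut j (x∈p∪q⁺ (inj₂ j∈Y)))
             (two-vertices⇒edge cY a≢b a∈Y b∈Y) nY)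
    where
    S = separationOf cut
    open Separation S
    sides : verts X ⊆ V₁ ⊎ verts X ⊆ V₂ → verts Y ⊆ V₁ ⊎ verts Y ⊆ V₂ → Empty.⊥
    sides (inj₁ X⊆V₁) (inj₁ Y⊆V₁) =
      side₁-proper cut λ v∈ → [ (λ v∈X → X⊆V₁ v∈X) , (λ v∈Y → Y⊆V₁ v∈Y) ] (x∈p∪q⁻ _ _ v∈)
    sides (inj₂ X⊆V₂) (inj₂ Y⊆V₂) =
      side₂-proper cut λ v∈ → [ (λ v∈X → X⊆V₂ v∈X) , (λ v∈Y → Y⊆V₂ v∈Y) ] (x∈p∪q⁻ _ _ v∈)
    sides (inj₁ X⊆V₁) (inj₂ Y⊆V₂) = a≢b (trans (meet (X⊆V₁ a∈X) (Y⊆V₂ a∈Y)) (sym (meet (X⊆V₁ b∈X) (Y⊆V₂ b∈Y))))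
    sides (inj₂ X⊆V₂) (inj₁ Y⊆V₁) = a≢b (trans (meet (Y⊆V₁ a∈Y) (X⊆V₂ a∈X)) (sym (meet (Y⊆V₁ b∈Y) (X⊆V₂ b∈X))))

  edgeSub : Fin k → Sub G
  edgeSub j = sub (E j) ⁅ j ⁆

  edgeSub-isSub : ∀ j → IsSub G (edgeSub j)
  edgeSub-isSub j j′ j′∈⁅j⁆ with x∈⁅y⁆⇒x≡y j j′∈⁅j⁆
  ... | refl = λ v∈ → v∈

  edgeSub-connected : ∀ j → Connected G (edgeSub j)
  edgeSub-connected j x y x∈ y∈ with x ≟ y
  ... | yes refl = stop x
  ... | no x≢y   = step j (x∈⁅x⁆ j) x∈ y∈ x≢y (stop y)

  edgeSub-noCutVertex : ∀ j → NoCutVertex G (edgeSub j)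
  edgeSub-noCutVertex j u cut with splits cut j (x∈⁅x⁆ j)
  ... | inj₁ j⊆V₁ = side₁-proper cut j⊆V₁
  ... | inj₂ j⊆V₂ = side₂-proper cut j⊆V₂

-- The block tree

module BlockTree {m} (2≤m : 2 ≤ m) (G : Hypergraph m) (cG : Connected G (whole G))
                 {x₀ y₀ : Fin (Hypergraph.n G)} (x₀≢y₀ : x₀ ≢ y₀)
                 {s} (B : Fin s → Sub G) (B-injective : Injective _≡_ _≡_ B)
                 (B-block : ∀ b → IsBlock G (B b))
                 (B-all : ∀ X → IsBlock G X → ∃[ b ] (B b ≡ X)) where
  open Hypergraph G
  open CutFree 2≤m G

  module _ (b : Fin s) where

    B-isSub : IsSub G (B b)
    B-isSub = proj₁ (B-block b)

    B-connected : Connected G (B b)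
    B-connected = proj₁ (proj₂ (B-block b))

    B-noCutVertex : NoCutVertex G (B b)
    B-noCutVertex = proj₁ (proj₂ (proj₂ (B-block b)))

    B-maximal : ∀ Y → IsSub G Y → Connected G Y → NoCutVertex G Y →
                verts (B b) ⊆ verts Y → edgs (B b) ⊆ edgs Y → edgs Y ⊆ edgs (B b)
    B-maximal = proj₂ (proj₂ (proj₂ (B-block b)))

  vertex-in-edge : ∀ v → ∃[ j ] (v ∈ E j)
  vertex-in-edge v with v ≟ x₀
  ... | no v≢x₀  = case Walk-first-edge (cG v x₀ ∈⊤ ∈⊤) v≢x₀ of λ { (j , _ , v∈j) → j , v∈j }
  ... | yes refl = case Walk-first-edge (cG v y₀ ∈⊤ ∈⊤) x₀≢y₀ of λ { (j , _ , v∈j) → j , v∈j }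

  -- an edgeless block has at most one vertex, so it would be swallowed by a single edge
  block-edge : ∀ b → Nonempty (edgs (B b))
  block-edge b with Finₚ.any? (_∈? edgs (B b))
  ... | yes ne = ne
  ... | no ¬ne = contradiction (j , B-maximal b (edgeSub j) (edgeSub-isSub j) (edgeSub-connected j)
                                      (edgeSub-noCutVertex j) B⊆j (λ j′∈B → ⊥-elim (¬ne (_ , j′∈B))) (x∈⁅x⁆ j))
                               ¬ne
    where
    edge-over-B : ∃[ j ] (verts (B b) ⊆ E j)
    edge-over-B with nonempty? (verts (B b))
    ... | no ¬ne′ = proj₁ (vertex-in-edge x₀) , λ {w} w∈B → ⊥-elim (¬ne′ (w , w∈B))
    ... | yes (v , v∈B) = proj₁ (vertex-in-edge v) , λ {w} w∈B → case w ≟ v of λ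
          { (yes refl) → proj₂ (vertex-in-edge v)
          ; (no w≢v) → ⊥-elim (¬ne (two-vertices⇒edge (B-connected b) w≢v w∈B v∈B)) }
    j = proj₁ edge-over-B
    B⊆j = proj₂ edge-over-B

  B-verts⊆ : ∀ b {A} → (∀ j → j ∈ edgs (B b) → E j ⊆ A) → verts (B b) ⊆ A
  B-verts⊆ b = verts⊆ (B-isSub b) (B-connected b) (block-edge b)

  B-one-side : ∀ b {u} (S : Separation u) → Splits G S (_∈ edgs (B b)) →
               verts (B b) ⊆ Separation.V₁ S ⊎ verts (B b) ⊆ Separation.V₂ S
  B-one-side b S split = cut-free⇒one-side (B-isSub b) (B-connected b) S split (block-edge b) (B-noCutVertex b)

  -- two blocks sharing an edge share two vertices, so their union is cut-free and maximality applies
  edge-block-unique : ∀ {j b b′} → j ∈ edgs (B b) → j ∈ edgs (B b′) → b ≡ b′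
  edge-block-unique {j} {b} {b′} j∈b j∈b′ with ∃-two-in-E j
  ... | x , y , x≢y , x∈j , y∈j =
    B-injective (cong₂ sub (⊆-antisym (verts-mono b b′ b⊆b′) (verts-mono b′ b b′⊆b)) (⊆-antisym b⊆b′ b′⊆b))
    where
    Z = B b ⊔ B b′
    sZ = ⊔-isSub (B-isSub b) (B-isSub b′)
    cZ = ⊔-connected (B-connected b) (B-connected b′) (B-isSub b j j∈b x∈j) (B-isSub b′ j j∈b′ x∈j)
    nZ = ⊔-noCutVertex (B-isSub b) (B-connected b) (B-noCutVertex b)
                       (B-isSub b′) (B-connected b′) (B-noCutVertex b′) x≢y
                       (B-isSub b j j∈b x∈j) (B-isSub b j j∈b y∈j) (B-isSub b′ j j∈b′ x∈j) (B-isSub b′ j j∈b′ y∈j)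
    b⊆b′ : edgs (B b) ⊆ edgs (B b′)
    b⊆b′ j∈ = B-maximal b′ Z sZ cZ nZ (x∈p∪q⁺ ∘ inj₂) (x∈p∪q⁺ ∘ inj₂) (x∈p∪q⁺ (inj₁ j∈))
    b′⊆b : edgs (B b′) ⊆ edgs (B b)
    b′⊆b j∈ = B-maximal b Z sZ cZ nZ (x∈p∪q⁺ ∘ inj₁) (x∈p∪q⁺ ∘ inj₁) (x∈p∪q⁺ (inj₂ j∈))
    verts-mono : ∀ c c′ → edgs (B c) ⊆ edgs (B c′) → verts (B c) ⊆ verts (B c′)
    verts-mono c c′ c⊆c′ = B-verts⊆ c λ j j∈c → B-isSub c′ j (c⊆c′ j∈c)

  -- an edge lying in no block would be contained in ever larger cut-free connected subgraphs
  edge-in-block : ∀ j → ∃[ b ] (j ∈ edgs (B b))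
  edge-in-block j with Finₚ.any? (λ b → j ∈? edgs (B b))
  ... | yes found = found
  ... | no none = ⊥-elim $ grow k (ℕₚ.m≤m+n k _)
                      (edgeSub-isSub j) (edgeSub-connected j) (edgeSub-noCutVertex j) (x∈⁅x⁆ j)
    where
    grow : ∀ N {Y : Sub G} → k ≤ N ℕ.+ ∣ edgs Y ∣ → IsSub G Y → Connected G Y → NoCutVertex G Y → j ∉ edgs Y
    maximal : ∀ N {Y : Sub G} → k ≤ N ℕ.+ ∣ edgs Y ∣ → j ∈ edgs Y →
              ∀ Y′ → IsSub G Y′ → Connected G Y′ → NoCutVertex G Y′ →
              verts Y ⊆ verts Y′ → edgs Y ⊆ edgs Y′ → edgs Y′ ⊆ edgs Y
    grow N bound sY cY nY j∈Y with B-all _ (sY , cY , nY , maximal N bound j∈Y)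
    ... | b , refl = none (b , j∈Y)
    maximal N {Y} bound j∈Y Y′ sY′ cY′ nY′ _ Y⊆Y′ with edgs Y′ ⊆? edgs Y
    ... | yes Y′⊆Y = Y′⊆Y
    ... | no  Y′⊈Y = ⊥-elim (larger N bound)
      where
      Y⊂Y′ : ∣ edgs Y ∣ < ∣ edgs Y′ ∣
      Y⊂Y′ = p⊂q⇒∣p∣<∣q∣ (Y⊆Y′ , ⊈⇒∃ Y′⊈Y)
      larger : ∀ N → k ≤ N ℕ.+ ∣ edgs Y ∣ → Empty.⊥
      larger zero    bound = ℕₚ.<⇒≱ (ℕₚ.<-≤-trans Y⊂Y′ (∣p∣≤n (edgs Y′))) bound
      larger (suc N) bound = grow N (≤-fuel-step bound Y⊂Y′) sY′ cY′ nY′ (Y⊆Y′ j∈Y)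

  vertex-in-block : ∀ v → ∃[ b ] (v ∈ verts (B b))
  vertex-in-block v with vertex-in-edge v
  ... | j , v∈j with edge-in-block j
  ...   | b , j∈b = b , B-isSub b j j∈b v∈j

  ⋃V : Subset s → Subset n
  ⋃V L = subsetOf (λ v → Finₚ.any? (λ b → b ∈? L ×-dec v ∈? verts (B b)))

  ⋃E : Subset s → Subset k
  ⋃E L = subsetOf (λ j → Finₚ.any? (λ b → b ∈? L ×-dec j ∈? edgs (B b)))

  ⋃ : Subset s → Sub G
  ⋃ L = sub (⋃V L) (⋃E L)

  ∈⋃V⁻ : ∀ {L v} → v ∈ ⋃V L → ∃[ b ] (b ∈ L × v ∈ verts (B b))
  ∈⋃V⁻ = ∈subsetOf⁻ _

  ∈⋃V⁺ : ∀ {L v b} → b ∈ L → v ∈ verts (B b) → v ∈ ⋃V L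
  ∈⋃V⁺ b∈L v∈b = ∈subsetOf⁺ _ (_ , b∈L , v∈b)

  ∈⋃E⁻ : ∀ {L j} → j ∈ ⋃E L → ∃[ b ] (b ∈ L × j ∈ edgs (B b))
  ∈⋃E⁻ = ∈subsetOf⁻ _

  ∈⋃E⁺ : ∀ {L j b} → b ∈ L → j ∈ edgs (B b) → j ∈ ⋃E L
  ∈⋃E⁺ b∈L j∈b = ∈subsetOf⁺ _ (_ , b∈L , j∈b)

  ⋃-isSub : ∀ L → IsSub G (⋃ L)
  ⋃-isSub L j j∈L v∈j with ∈⋃E⁻ j∈L
  ... | b , b∈L , j∈b = ∈⋃V⁺ b∈L (B-isSub b j j∈b v∈j)

  module Sides (L : Subset s) {u : Fin n} (S : Separation u) (split : Splits G S (_∈ ⋃E L)) where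
    open Separation S

    L₁ : Subset s
    L₁ = subsetOf (λ b → b ∈? L ×-dec verts (B b) ⊆? V₁)

    L₁⊆L : L₁ ⊆ L
    L₁⊆L b∈L₁ = proj₁ (∈subsetOf⁻ _ b∈L₁)

    L₁-on-V₁ : ∀ {b} → b ∈ L₁ → verts (B b) ⊆ V₁
    L₁-on-V₁ b∈L₁ = proj₂ (∈subsetOf⁻ _ b∈L₁)

    L∖L₁-on-V₂ : ∀ {b} → b ∈ L → b ∉ L₁ → verts (B b) ⊆ V₂
    L∖L₁-on-V₂ {b} b∈L b∉L₁ with B-one-side b S (λ j j∈b → split j (∈⋃E⁺ b∈L j∈b))
    ... | inj₁ b⊆V₁ = ⊥-elim (b∉L₁ (∈subsetOf⁺ _ (b∈L , λ {v} → b⊆V₁ {v})))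
    ... | inj₂ b⊆V₂ = b⊆V₂

    ⋃L₁⊆V₁ : ⋃V L₁ ⊆ V₁
    ⋃L₁⊆V₁ v∈ with ∈⋃V⁻ v∈
    ... | b , b∈L₁ , v∈b = L₁-on-V₁ b∈L₁ v∈b

    ⋃L₁⊆⋃L : ⋃V L₁ ⊆ ⋃V L
    ⋃L₁⊆⋃L v∈ with ∈⋃V⁻ v∈
    ... | b , b∈L₁ , v∈b = ∈⋃V⁺ (L₁⊆L b∈L₁) v∈b

    L₁⊂L : ∀ {w} → w ∈ ⋃V L → w ∉ V₁ → ∣ L₁ ∣ < ∣ L ∣
    L₁⊂L w∈L w∉V₁ with ∈⋃V⁻ w∈L
    ... | b , b∈L , w∈b = p⊂q⇒∣p∣<∣q∣ (L₁⊆L , b , b∈L , λ b∈L₁ → w∉V₁ (L₁-on-V₁ b∈L₁ w∈b))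

    V₁-vertex : ∀ {v} → v ∈ ⋃V L → v ∈ V₁ → v ∈ ⋃V L₁ ⊎ v ≡ u
    V₁-vertex v∈L v∈V₁ with ∈⋃V⁻ v∈L
    ... | b , b∈L , v∈b with b ∈? L₁
    ...   | yes b∈L₁ = inj₁ (∈⋃V⁺ b∈L₁ v∈b)
    ...   | no b∉L₁  = inj₂ (meet v∈V₁ (L∖L₁-on-V₂ b∈L b∉L₁ v∈b))

    V₁-edge : ∀ {j} → j ∈ ⋃E L → E j ⊆ V₁ → j ∈ ⋃E L₁
    V₁-edge {j} j∈L j⊆V₁ with ∈⋃E⁻ j∈L
    ... | b , b∈L , j∈b with b ∈? L₁
    ...   | yes b∈L₁ = ∈⋃E⁺ b∈L₁ j∈b
    ...   | no b∉L₁  = ⊥-elim (2≤∣p∣⇒p⊈⁅u⁆ (2≤∣E∣ j) λ v∈j →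
                         subst (_∈ ⁅ u ⁆) (sym (meet (j⊆V₁ v∈j) (L∖L₁-on-V₂ b∈L b∉L₁ (B-isSub b j j∈b v∈j))))
                               (x∈⁅x⁆ u))

    ⋃L₁-connected : Connected G (⋃ L) → Connected G (⋃ L₁)
    ⋃L₁-connected cL x y x∈ y∈ = Walk-map (λ j (j∈L , j⊆V₁) → V₁-edge j∈L j⊆V₁)
      (Walk-restrict S split (cL x y (⋃L₁⊆⋃L x∈) (⋃L₁⊆⋃L y∈)) (⋃L₁⊆V₁ x∈) (⋃L₁⊆V₁ y∈))

    -- a walk in ⋃ L from w ∉ V₁ into ⋃ L₁ enters V₁ through u along an edge of L₁
    u∈⋃L₁ : Connected G (⋃ L) → ∀ {w} → w ∈ ⋃V L → w ∉ V₁ → Nonempty (⋃V L₁) → u ∈ ⋃V L₁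
    u∈⋃L₁ cL w∈L w∉V₁ (z , z∈L₁) with u ≟ z
    ... | yes refl = z∈L₁
    ... | no u≢z with Walk-first-edge (Walk-through-u S split (cL _ z w∈L (⋃L₁⊆⋃L z∈L₁)) w∉V₁ (⋃L₁⊆V₁ z∈L₁)) u≢z
    ...   | j , (j∈L , j⊆V₁) , u∈j = ⋃-isSub L₁ j (V₁-edge j∈L j⊆V₁) u∈j

  -- if B b met ⋃ L twice, B b ⊔ ⋃ L would be cut-free (contradicting maximality of B b), or a cut
  -- vertex would leave B b together with a strictly smaller connected family L₁ ⊂ L on one side,
  -- still meeting B b twice
  ¬outer-block-meets-twice : ∀ N L → ∣ L ∣ < N → ∀ {b} → b ∉ L → Connected G (⋃ L) →
    ∀ {x y} → x ≢ y → x ∈ verts (B b) → y ∈ verts (B b) → x ∈ ⋃V L → y ∈ ⋃V L → Empty.⊥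
  ¬outer-block-meets-twice (suc N) L (s≤s ∣L∣≤N) {b} b∉L cL {x} {y} x≢y x∈b y∈b x∈L y∈L =
    cut-free⇒⊥ (λ u cut → cut⇒⊥ cut)
    where
    Y = B b ⊔ ⋃ L
    sY = ⊔-isSub (B-isSub b) (⋃-isSub L)
    cY = ⊔-connected (B-connected b) cL x∈b x∈L

    cut-free⇒⊥ : NoCutVertex G Y → Empty.⊥
    cut-free⇒⊥ nY with ∈⋃V⁻ x∈L
    ... | c , c∈L , _ with block-edge c
    ...   | j , j∈c = b∉L (subst (_∈ L) (edge-block-unique j∈c j∈b) c∈L)
      where
      j∈b = B-maximal b Y sY cY nY (x∈p∪q⁺ ∘ inj₁) (x∈p∪q⁺ ∘ inj₁) (x∈p∪q⁺ (inj₂ (∈⋃E⁺ c∈L j∈c)))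

    module _ {u : Fin n} (S : Separation u) (split : Splits G S (_∈ edgs Y))
             (b⊆V₁ : verts (B b) ⊆ Separation.V₁ S) {w} (w∈Y : w ∈ verts Y) (w∉V₁ : w ∉ Separation.V₁ S) where
      open Separation S
      open Sides L S (λ j j∈L → split j (x∈p∪q⁺ (inj₂ j∈L)))

      w∈L : w ∈ ⋃V L
      w∈L = [ (λ w∈b → contradiction (b⊆V₁ w∈b) w∉V₁) , Function.id ] (x∈p∪q⁻ _ _ w∈Y)

      IH : x ∈ ⋃V L₁ → y ∈ ⋃V L₁ → Empty.⊥
      IH = ¬outer-block-meets-twice N L₁ (ℕₚ.<-≤-trans (L₁⊂L w∈L w∉V₁) ∣L∣≤N) (b∉L ∘ L₁⊆L)
                                    (⋃L₁-connected cL) x≢y x∈b y∈b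

      B-vertex∈⋃L₁ : Nonempty (⋃V L₁) → ∀ {v} → v ∈ ⋃V L → v ∈ verts (B b) → v ∈ ⋃V L₁
      B-vertex∈⋃L₁ ne v∈L v∈b with V₁-vertex v∈L (b⊆V₁ v∈b)
      ... | inj₁ v∈L₁ = v∈L₁
      ... | inj₂ refl = u∈⋃L₁ cL w∈L w∉V₁ ne

      B-on-V₁⇒⊥ : Empty.⊥
      B-on-V₁⇒⊥ with V₁-vertex x∈L (b⊆V₁ x∈b) | V₁-vertex y∈L (b⊆V₁ y∈b)
      ... | inj₂ refl  | inj₂ refl  = x≢y refl
      ... | inj₁ x∈L₁ | _          = IH x∈L₁ (B-vertex∈⋃L₁ (_ , x∈L₁) y∈L y∈b)
      ... | _          | inj₁ y∈L₁ = IH (B-vertex∈⋃L₁ (_ , y∈L₁) x∈L x∈b) y∈L₁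

    cut⇒⊥ : ∀ {u} → IsCutVertex G Y u → Empty.⊥
    cut⇒⊥ cut with B-one-side b S (λ j j∈b → splits cut j (x∈p∪q⁺ (inj₁ j∈b)))
      where S = separationOf cut
    ... | inj₁ b⊆V₁ = let w , w∈Y , w∉V₁ = ⊈⇒∃ (side₁-proper cut) in
      B-on-V₁⇒⊥ (separationOf cut) (splits cut) b⊆V₁ w∈Y w∉V₁
    ... | inj₂ b⊆V₂ = let w , w∈Y , w∉V₂ = ⊈⇒∃ (side₂-proper cut) in
      B-on-V₁⇒⊥ (swap (separationOf cut)) (Splits-swap {G = G} {S = separationOf cut} (splits cut)) b⊆V₂ w∈Y w∉V₂

  root : Fin n
  root = proj₁ (least (∈⊤ {x = x₀}))

  root-least : IsLeast ⊤ root
  root-least = proj₂ (least (∈⊤ {x = x₀}))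

  -- with the root included, the first block is attached at the root
  W : Subset s → Subset n
  W L = ⁅ root ⁆ ∪ ⋃V L

  ∈W : ∀ {L b v} → b ∈ L → v ∈ verts (B b) → v ∈ W L
  ∈W b∈L v∈b = x∈p∪q⁺ (inj₂ (∈⋃V⁺ b∈L v∈b))

  W-∅ : ∀ {L} → (∀ b → b ∉ L) → ∀ {v} → v ∈ W L → v ≡ root
  W-∅ {L} empty v∈W with x∈p∪q⁻ _ _ v∈W
  ... | inj₁ v∈⁅r⁆ = x∈⁅y⁆⇒x≡y root v∈⁅r⁆
  ... | inj₂ v∈L   = ⊥-elim (empty _ (proj₁ (proj₂ (∈⋃V⁻ v∈L))))

  W-∪⁻ : ∀ {L b v} → v ∈ W (L ∪ ⁅ b ⁆) → v ∈ W L ⊎ v ∈ verts (B b)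
  W-∪⁻ {L} {b} v∈W with x∈p∪q⁻ _ _ v∈W
  ... | inj₁ v∈⁅r⁆ = inj₁ (x∈p∪q⁺ (inj₁ v∈⁅r⁆))
  ... | inj₂ v∈L′ with ∈⋃V⁻ v∈L′
  ...   | c , c∈L′ , v∈c with x∈p∪q⁻ L _ c∈L′
  ...     | inj₁ c∈L   = inj₁ (∈W c∈L v∈c)
  ...     | inj₂ c∈⁅b⁆ = inj₂ (subst (λ c → _ ∈ verts (B c)) (x∈⁅y⁆⇒x≡y b c∈⁅b⁆) v∈c)

  W-∪-old : ∀ {L b v} → v ∈ W (L ∪ ⁅ b ⁆) → v ∉ verts (B b) → v ∈ W L
  W-∪-old {L} {b} v∈W v∉b with W-∪⁻ {L} {b} v∈W
  ... | inj₁ v∈WL = v∈WL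
  ... | inj₂ v∈b  = contradiction v∈b v∉b

  RootedConnected : Subset s → Set
  RootedConnected L = Connected′ G (W L) (_∈ ⋃E L)

  block-vertex : ∀ b → Nonempty (verts (B b))
  block-vertex b with block-edge b
  ... | j , j∈b with ∃-two-in-E j
  ...   | x , _ , _ , x∈j , _ = x , B-isSub b j j∈b x∈j

  W⊆⋃V : ∀ {L c} → RootedConnected L → c ∈ L → W L ⊆ ⋃V L
  W⊆⋃V {L} {c} cW c∈L v∈W with x∈p∪q⁻ _ _ v∈W | block-vertex c
  ... | inj₂ v∈L   | _ = v∈L
  ... | inj₁ v∈⁅r⁆ | z , z∈c with x∈⁅y⁆⇒x≡y root v∈⁅r⁆ | root ≟ z
  ...   | refl | yes refl = ∈⋃V⁺ c∈L z∈c
  ...   | refl | no r≢z with Walk-first-edge (cW root z v∈W (∈W c∈L z∈c)) r≢z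
  ...     | j , j∈L , r∈j = ⋃-isSub L j j∈L r∈j

  attach-unique : ∀ {L b a w} → RootedConnected L → b ∉ L → a ∈ verts (B b) → a ∈ W L →
                  w ∈ verts (B b) → w ∈ W L → w ≡ a
  attach-unique {L} {b} {a} {w} cW b∉L a∈b a∈W w∈b w∈W with Finₚ.any? (_∈? L)
  ... | no empty = trans (W-∅ (λ c c∈L → empty (c , c∈L)) w∈W) (sym (W-∅ (λ c c∈L → empty (c , c∈L)) a∈W))
  ... | yes (c , c∈L) = decidable-stable (w ≟ a) λ w≢a →
    ¬outer-block-meets-twice (suc ∣ L ∣) L ℕₚ.≤-refl b∉L
      (λ x y x∈ y∈ → cW x y (x∈p∪q⁺ (inj₂ x∈)) (x∈p∪q⁺ (inj₂ y∈)))
                             w≢a w∈b a∈b (W⊆⋃V cW c∈L w∈W) (W⊆⋃V cW c∈L a∈W)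

  attach-connected : ∀ {L b a} → RootedConnected L → a ∈ verts (B b) → a ∈ W L → RootedConnected (L ∪ ⁅ b ⁆)
  attach-connected {L} {b} cW a∈b a∈W = Connected′-∪ cW (B-connected b) a∈W a∈b
    (λ v∈ → x∈p∪q⁺ (W-∪⁻ v∈))
    (λ j j∈L → case ∈⋃E⁻ j∈L of λ { (c , c∈L , j∈c) → ∈⋃E⁺ (x∈p∪q⁺ (inj₁ c∈L)) j∈c })
    (λ j j∈b → ∈⋃E⁺ (x∈p∪q⁺ (inj₂ (x∈⁅x⁆ b))) j∈b)

  data Ordering : Subset s → Set where
    []     : Ordering ⊥
    attach : ∀ {L} → Ordering L → ∀ b → b ∉ L → ∀ a → a ∈ verts (B b) → a ∈ W L →
             (∀ {w} → w ∈ verts (B b) → w ∈ W L → w ≡ a) → Ordering (L ∪ ⁅ b ⁆)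

  -- W L is closed along edges unless some block outside L touches it; walking from the root
  -- then reaches every block
  all-attached : ∀ {L} → (∀ b → b ∉ L → Empty (verts (B b) ∩ W L)) → ∀ b → b ∈ L
  all-attached {L} untouched b with b ∈? L
  ... | yes b∈L = b∈L
  ... | no b∉L with block-vertex b
  ...   | y , y∈b = ⊥-elim (untouched b b∉L (y , x∈p∩q⁺ (y∈b , y∈W)))
    where
    closed : ∀ j → j ∈ ⊤ → ∀ {v} → v ∈ E j → v ∈ W L → E j ⊆ W L
    closed j _ v∈j v∈W with edge-in-block j
    ... | c , j∈c with c ∈? L
    ...   | yes c∈L = λ v′∈j → ∈W c∈L (B-isSub c j j∈c v′∈j)
    ...   | no c∉L  = ⊥-elim (untouched c c∉L (_ , x∈p∩q⁺ (B-isSub c j j∈c v∈j , v∈W)))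
    y∈W : y ∈ W L
    y∈W = Walk-closed (W L) closed (cG root y ∈⊤ ∈⊤) (x∈p∪q⁺ (inj₁ (x∈⁅x⁆ root)))

  ordering-from : ∀ N L → s ≤ N ℕ.+ ∣ L ∣ → Ordering L → RootedConnected L → Ordering ⊤
  ordering-from zero L bound o _ = subst Ordering (∣p∣≡n⇒p≡⊤ (ℕₚ.≤-antisym (∣p∣≤n L) bound)) o
  ordering-from (suc N) L bound o cW
    with Finₚ.any? (λ b → ¬? (b ∈? L) ×-dec nonempty? (verts (B b) ∩ W L))
  ... | no untouched =
    subst Ordering (⊆-antisym ⊆⊤ (λ {b} _ → all-attached (λ b b∉L ne → untouched (b , b∉L , ne)) b)) o
  ... | yes (b , b∉L , a , a∈b∩W) = ordering-from N (L ∪ ⁅ b ⁆)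
      (≤-fuel-step bound (p⊂q⇒∣p∣<∣q∣ (p⊆p∪q ⁅ b ⁆ , b , x∈p∪q⁺ (inj₂ (x∈⁅x⁆ b)) , b∉L)))
      (attach o b b∉L a a∈b a∈W (λ w∈b w∈W → attach-unique cW b∉L a∈b a∈W w∈b w∈W))
      (attach-connected cW a∈b a∈W)
    where
    a∈b = proj₁ (x∈p∩q⁻ _ _ a∈b∩W)
    a∈W = proj₂ (x∈p∩q⁻ _ _ a∈b∩W)

  ordering : Ordering ⊤
  ordering = ordering-from s ⊥ (ℕₚ.m≤m+n s _) [] λ x y x∈W y∈W →
    subst (λ z → Walk G _ x z) (trans (W-∅ (λ _ → ∉⊥) x∈W) (sym (W-∅ (λ _ → ∉⊥) y∈W))) (stop x)

  W⊤ : ∀ v → v ∈ W ⊤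
  W⊤ v with vertex-in-block v
  ... | b , v∈b = ∈W ∈⊤ v∈b

-- Stabilising diagonal matrices

module FieldProperties {c ℓ} (K : ACField c ℓ) where
  open ACField K renaming (refl to ≈-refl; sym to ≈-sym; trans to ≈-trans)
  open import Relation.Binary.Reasoning.Setoid setoid

  infix 4 _≉0
  _≉0 : Carrier → Set ℓ
  x ≉0 = ¬ x ≈ 0#

  inv-correctˡ : ∀ x p → inv x p * x ≈ 1#
  inv-correctˡ x p = ≈-trans (*-comm _ _) (inv-correct x p)

  inv-unique : ∀ x p {y} → x * y ≈ 1# → y ≈ inv x p
  inv-unique x p {y} xy≈1 = begin
    y                 ≈⟨ *-identityˡ y ⟨
    1# * y            ≈⟨ *-congʳ (inv-correctˡ x p) ⟨
    (inv x p * x) * y ≈⟨ *-assoc _ _ _ ⟩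
    inv x p * (x * y) ≈⟨ *-congˡ xy≈1 ⟩
    inv x p * 1#      ≈⟨ *-identityʳ _ ⟩
    inv x p           ∎

  *-≉0 : ∀ {x y} → x ≉0 → y ≉0 → x * y ≉0
  *-≉0 {x} {y} x≉0 y≉0 xy≈0 = y≉0 (begin
    y                 ≈⟨ *-identityˡ y ⟨
    1# * y            ≈⟨ *-congʳ (inv-correctˡ x x≉0) ⟨
    (inv x x≉0 * x) * y ≈⟨ *-assoc _ _ _ ⟩
    inv x x≉0 * (x * y) ≈⟨ *-congˡ xy≈0 ⟩
    inv x x≉0 * 0#      ≈⟨ zeroʳ _ ⟩
    0#                ∎)

  inv-≉0 : ∀ x p → inv x p ≉0
  inv-≉0 x p inv≈0 = nontrivial (begin
    1#          ≈⟨ inv-correct x p ⟨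
    x * inv x p ≈⟨ *-congˡ inv≈0 ⟩
    x * 0#      ≈⟨ zeroʳ x ⟩
    0#          ∎)

  inv-cong : ∀ {x y} p q → x ≈ y → inv x p ≈ inv y q
  inv-cong {x} {y} p q x≈y = inv-unique y q (≈-trans (*-congʳ (≈-sym x≈y)) (inv-correct x p))

  inv-* : ∀ {x y} p q r → inv (x * y) r ≈ inv x p * inv y q
  inv-* {x} {y} p q r = ≈-sym (inv-unique (x * y) r (begin
    (x * y) * (inv x p * inv y q) ≈⟨ interchange x y _ _ ⟩
    (x * inv x p) * (y * inv y q) ≈⟨ *-cong (inv-correct x p) (inv-correct y q) ⟩
    1# * 1#                       ≈⟨ *-identityˡ 1# ⟩
    1#                            ∎))
    where open import Algebra.Properties.CommutativeSemigroup *-commutativeSemigroup using (interchange)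

  inv-cancelˡ : ∀ x p y → inv x p * (x * y) ≈ y
  inv-cancelˡ x p y = begin
    inv x p * (x * y) ≈⟨ *-assoc _ _ _ ⟨
    (inv x p * x) * y ≈⟨ *-congʳ (inv-correctˡ x p) ⟩
    1# * y            ≈⟨ *-identityˡ y ⟩
    y                 ∎

module Stabilisers {c ℓ} (K : ACField c ℓ) {m} (G : Hypergraph m) where
  open ACField K renaming (refl to ≈-refl; sym to ≈-sym; trans to ≈-trans)
  open FieldProperties K
  open Hypergraph G
  open import Relation.Binary.Reasoning.Setoid setoid
  open import Algebra.Properties.CommutativeSemigroup *-commutativeSemigroup using (interchange)
  open import Algebra.Solver.CommutativeMonoid *-commutativeMonoid using (solve; _⊜_; _⊕_)

  infixr 8 _^_
  _^_ : Carrier → ℕ → Carrier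
  _^_ = pow G K

  ∏ᵛ : ∀ {t} → Vec Carrier t → Carrier
  ∏ᵛ = prodV G K

  ^-cong : ∀ {x y} t → x ≈ y → x ^ t ≈ y ^ t
  ^-cong zero    x≈y = ≈-refl
  ^-cong (suc t) x≈y = *-cong x≈y (^-cong t x≈y)

  ^-distrib-* : ∀ x y t → (x * y) ^ t ≈ x ^ t * y ^ t
  ^-distrib-* x y zero    = ≈-sym (*-identityˡ 1#)
  ^-distrib-* x y (suc t) = ≈-trans (*-congˡ (^-distrib-* x y t)) (interchange x y _ _)

  1^t≈1 : ∀ t → 1# ^ t ≈ 1#
  1^t≈1 zero    = ≈-refl
  1^t≈1 (suc t) = ≈-trans (*-identityˡ _) (1^t≈1 t)

  ∏ᵛ-map-scale : ∀ {t} x (f : Fin n → Carrier) (is : Vec (Fin n) t) →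
                 ∏ᵛ (Vec.map (λ v → x * f v) is) ≈ x ^ t * ∏ᵛ (Vec.map f is)
  ∏ᵛ-map-scale x f []       = ≈-sym (*-identityʳ 1#)
  ∏ᵛ-map-scale x f (i ∷ is) = ≈-trans (*-congˡ (∏ᵛ-map-scale x f is)) (interchange x (f i) _ _)

  ∏ᵛ-map-cong : ∀ {t S} {f g : Fin n → Carrier} → (∀ {v} → v ∈ S → f v ≈ g v) →
                (is : Vec (Fin n) t) → All (_∈ S) is → ∏ᵛ (Vec.map f is) ≈ ∏ᵛ (Vec.map g is)
  ∏ᵛ-map-cong f≈g []       []            = ≈-refl
  ∏ᵛ-map-cong f≈g (i ∷ is) (i∈S ∷ is∈S) = *-cong (f≈g i∈S) (∏ᵛ-map-cong f≈g is is∈S)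

  isEdge⁻ : ∀ X S → isEdge G X S ≡ true → ∃[ j ] (j ∈ edgs X × E j ≡ S)
  isEdge⁻ X S isEdge≡true with Any.satisfied (Anyₚ.any⁻ _ (allFin k) (Equivalence.from Boolₚ.T-≡ isEdge≡true))
  ... | j , T[j∈X∧Ej≡S] with Equivalence.to Boolₚ.T-∧ T[j∈X∧Ej≡S]
  ...   | T[j∈X] , T[Ej≡S] =
    j , Vecₚ.lookup⇒[]= j (edgs X) (Equivalence.to Boolₚ.T-≡ T[j∈X]) , toWitness T[Ej≡S]

  isEdge⁺ : ∀ {X S j} → j ∈ edgs X → E j ≡ S → isEdge G X S ≡ true
  isEdge⁺ {j = j} j∈X Ej≡S = Equivalence.to Boolₚ.T-≡ (Anyₚ.any⁺ _ (List.lose (Listₚ.∈-allFin j)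
    (Equivalence.from Boolₚ.T-∧ (Equivalence.from Boolₚ.T-≡ (Vecₚ.[]=⇒lookup j∈X) , fromWitness Ej≡S))))

  adj-shared : ∀ X Y {j} i is → j ∈ edgs X → j ∈ edgs Y → E j ≡ entrySet G i is →
               adj G K X i is ≡ adj G K Y i is
  adj-shared X Y i is j∈X j∈Y Ej≡ =
    cong (λ b → if b then _ else 0#) (trans (isEdge⁺ {X} j∈X Ej≡) (sym (isEdge⁺ {Y} j∈Y Ej≡)))

  adj-off-edge : ∀ {X i is} → isEdge G X (entrySet G i is) ≡ false → adj G K X i is ≡ 0#
  adj-off-edge ≡false = cong (λ b → if b then _ else 0#) ≡false

  ∈entrySet : ∀ {t} i (is : Vec (Fin n) t) → i ∈ Vec.foldr (λ _ → Subset n) (λ v S → ⁅ v ⁆ ∪ S) ⁅ i ⁆ is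
  ∈entrySet i []       = x∈⁅x⁆ i
  ∈entrySet i (v ∷ is) = x∈p∪q⁺ (inj₂ (∈entrySet i is))

  entrySet-∋ : ∀ {t} i (is : Vec (Fin n) t) → All (_∈ Vec.foldr (λ _ → Subset n) (λ v S → ⁅ v ⁆ ∪ S) ⁅ i ⁆ is) is
  entrySet-∋ i []       = []
  entrySet-∋ i (v ∷ is) = x∈p∪q⁺ (inj₁ (x∈⁅x⁆ v)) ∷ All.map (λ v∈ → x∈p∪q⁺ (inj₂ v∈)) (entrySet-∋ i is)

  Balanced : Sub G → (f : Fin n → Carrier) → ∀ i → f i ≉0 → Vec (Fin n) (m ∸ 1) → Set ℓ
  Balanced X f i p is = inv (f i) p ^ (m ∸ 1) * adj G K X i is * ∏ᵛ (Vec.map f is) ≈ adj G K X i is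

  -- entries of the adjacency tensor off the edges vanish, so only edges need checking
  balanced-by-edges : ∀ X {f} i {p} is → (∀ {j} → j ∈ edgs X → E j ≡ entrySet G i is → Balanced X f i p is) →
                      Balanced X f i p is
  balanced-by-edges X {f} i {p} is on-edges = by-cases (isEdge G X (entrySet G i is)) refl
    where
    by-cases : ∀ b → isEdge G X (entrySet G i is) ≡ b → Balanced X f i p is
    by-cases true isEdge≡true with isEdge⁻ X _ isEdge≡true
    ... | j , j∈X , Ej≡ = on-edges j∈X Ej≡
    by-cases false isEdge≡false = begin
      inv (f i) p ^ (m ∸ 1) * adj G K X i is * ∏ᵛ (Vec.map f is) ≈⟨ *-congʳ (*-congˡ (reflexive adj≡0)) ⟩
      inv (f i) p ^ (m ∸ 1) * 0# * ∏ᵛ (Vec.map f is)             ≈⟨ *-congʳ (zeroʳ _) ⟩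
      0# * ∏ᵛ (Vec.map f is)                                      ≈⟨ zeroˡ _ ⟩
      0#                                                          ≡⟨ sym adj≡0 ⟩
      adj G K X i is                                              ∎
      where adj≡0 = adj-off-edge {X} {i} {is} isEdge≡false

  balanced-transfer : ∀ X Y {f} i {p q} is → adj G K X i is ≡ adj G K Y i is →
                      Balanced X f i p is → Balanced Y f i q is
  balanced-transfer X Y {f} i {p} {q} is adj≡ bal = begin
    inv (f i) q ^ (m ∸ 1) * adj G K Y i is * ∏ᵛ (Vec.map f is)
      ≈⟨ *-congʳ (*-cong (^-cong (m ∸ 1) (inv-cong q p ≈-refl)) (reflexive (sym adj≡))) ⟩
    inv (f i) p ^ (m ∸ 1) * adj G K X i is * ∏ᵛ (Vec.map f is) ≈⟨ bal ⟩
    adj G K X i is ≡⟨ adj≡ ⟩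
    adj G K Y i is ∎

  -- a stabilising diagonal matrix of X, not yet normalised at the least vertex
  record Stabilising (X : Sub G) (f : Fin n → Carrier) : Set ℓ where
    field
      f≉0      : ∀ i → i ∈ verts X → f i ≉0
      balanced : ∀ i (i∈X : i ∈ verts X) is → All (_∈ verts X) is → Balanced X f i (f≉0 i i∈X) is
  open Stabilising

  stabilising : ∀ {X} (D : Stab G K X) → Stabilising X (d D)
  stabilising D = record { f≉0 = nonzero D ; balanced = stab D }

  Stabilising-cong : ∀ {X f g} → (∀ {v} → v ∈ verts X → f v ≈ g v) → Stabilising X f → Stabilising X g
  Stabilising-cong {X} {f} {g} f≈g st = record
    { f≉0      = g≉0
    ; balanced = λ i i∈X is is∈X → begin
        inv (g i) (g≉0 i i∈X) ^ (m ∸ 1) * adj G K X i is * ∏ᵛ (Vec.map g is)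
          ≈⟨ *-cong (*-congʳ (^-cong (m ∸ 1) (inv-cong _ _ (≈-sym (f≈g i∈X))))) (≈-sym (∏ᵛ-map-cong f≈g is is∈X)) ⟩
        inv (f i) (f≉0 st i i∈X) ^ (m ∸ 1) * adj G K X i is * ∏ᵛ (Vec.map f is) ≈⟨ balanced st i i∈X is is∈X ⟩
        adj G K X i is ∎ }
    where
    g≉0 : ∀ i → i ∈ verts X → g i ≉0
    g≉0 i i∈X g≈0 = f≉0 st i i∈X (≈-trans (f≈g i∈X) g≈0)

  Stabilising-scale : ∀ {X f x} → x ≉0 → Stabilising X f → Stabilising X (λ v → x * f v)
  Stabilising-scale {X} {f} {x} x≉0 st = record
    { f≉0      = xf≉0
    ; balanced = λ i i∈X is is∈X → let a = adj G K X i is; y = inv (f i) (f≉0 st i i∈X) in begin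
        inv (x * f i) (xf≉0 i i∈X) ^ (m ∸ 1) * a * ∏ᵛ (Vec.map (λ v → x * f v) is)
          ≈⟨ *-cong (*-congʳ (≈-trans (^-cong (m ∸ 1) (inv-* x≉0 _ _)) (^-distrib-* _ _ (m ∸ 1))))
                    (∏ᵛ-map-scale x f is) ⟩
        (inv x x≉0 ^ (m ∸ 1) * y ^ (m ∸ 1)) * a * (x ^ (m ∸ 1) * ∏ᵛ (Vec.map f is))
          ≈⟨ regroup _ _ _ _ _ ⟩
        (inv x x≉0 ^ (m ∸ 1) * x ^ (m ∸ 1)) * (y ^ (m ∸ 1) * a * ∏ᵛ (Vec.map f is))
          ≈⟨ *-cong cancel (balanced st i i∈X is is∈X) ⟩
        1# * a ≈⟨ *-identityˡ a ⟩
        a ∎ }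
    where
    xf≉0 : ∀ i → i ∈ verts X → x * f i ≉0
    xf≉0 i i∈X = *-≉0 x≉0 (f≉0 st i i∈X)
    regroup : ∀ p q r s t → (p * q) * r * (s * t) ≈ (p * s) * ((q * r) * t)
    regroup = solve 5 (λ p q r s t → ((p ⊕ q) ⊕ r) ⊕ (s ⊕ t) ⊜ (p ⊕ s) ⊕ ((q ⊕ r) ⊕ t)) ≈-refl
    cancel : inv x x≉0 ^ (m ∸ 1) * x ^ (m ∸ 1) ≈ 1#
    cancel = ≈-trans (≈-sym (^-distrib-* _ _ (m ∸ 1)))
                     (≈-trans (^-cong (m ∸ 1) (inv-correctˡ x x≉0)) (1^t≈1 (m ∸ 1)))

  Stabilising-restrict : ∀ {X Y f} → verts X ⊆ verts Y → edgs X ⊆ edgs Y → Stabilising Y f → Stabilising X f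
  Stabilising-restrict {X} {Y} VX⊆VY EX⊆EY st = record
    { f≉0      = λ i i∈X → f≉0 st i (VX⊆VY i∈X)
    ; balanced = λ i i∈X is is∈X → balanced-by-edges X i is λ j∈X Ej≡ →
        balanced-transfer Y X i is (adj-shared Y X i is (EX⊆EY j∈X) j∈X Ej≡)
          (balanced st i (VX⊆VY i∈X) is (All.map VX⊆VY is∈X)) }

  Stabilising-glue : ∀ {Y f} → (∀ i → i ∈ verts Y → f i ≉0) →
                     (∀ j → j ∈ edgs Y → ∃[ X ] (j ∈ edgs X × IsSub G X × Stabilising X f)) → Stabilising Y f
  Stabilising-glue {Y} {f} f≉0′ pieces = record
    { f≉0      = f≉0′
    ; balanced = λ i i∈Y is _ → balanced-by-edges Y i is λ {j} j∈Y Ej≡ → case pieces j j∈Y of λ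
        { (X , j∈X , sX , st) → let entry⊆X = λ {v} v∈ → sX j j∈X (subst (v ∈_) (sym Ej≡) v∈) in
            balanced-transfer X Y i is (adj-shared X Y i is j∈X j∈Y Ej≡)
              (balanced st i (entry⊆X (∈entrySet i is)) is (All.map entry⊆X (entrySet-∋ i is))) } }

  normalise : ∀ {X f r} → IsLeast (verts X) r → Stabilising X f → Stab G K X
  normalise {X} {f} {r} r-least@(r∈X , _) st = record
    { d       = λ v → inv (f r) (f≉0 st r r∈X) * f v
    ; nonzero = f≉0 scaled
    ; first   = λ i i∈X i-least → case least-unique (i∈X , i-least) r-least of λ { refl → inv-correctˡ _ _ }
    ; stab    = balanced scaled }
    where scaled = Stabilising-scale (inv-≉0 _ _) st

-- The product formula

Π-setoid : ∀ {a ℓ} {I : Set} → (I → Setoid a ℓ) → Setoid a ℓ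
Π-setoid S = record
  { Carrier       = ∀ i → Setoid.Carrier (S i)
  ; _≈_           = λ f g → ∀ i → Setoid._≈_ (S i) (f i) (g i)
  ; isEquivalence = record
    { refl  = λ i → Setoid.refl (S i)
    ; sym   = λ f≈g i → Setoid.sym (S i) (f≈g i)
    ; trans = λ f≈g g≈h i → Setoid.trans (S i) (f≈g i) (g≈h i) } }

Π-inverse : ∀ {a₁ ℓ₁ a₂ ℓ₂} {I : Set} {S : I → Setoid a₁ ℓ₁} {T : I → Setoid a₂ ℓ₂} →
            (∀ i → Inverse (S i) (T i)) → Inverse (Π-setoid S) (Π-setoid T)
Π-inverse S↔T = record
  { to        = λ f i → Inverse.to (S↔T i) (f i)
  ; from      = λ g i → Inverse.from (S↔T i) (g i)
  ; to-cong   = λ f≈g i → Inverse.to-cong (S↔T i) (f≈g i)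
  ; from-cong = λ f≈g i → Inverse.from-cong (S↔T i) (f≈g i)
  ; inverse   = (λ eq i → Inverse.inverseˡ (S↔T i) (eq i)) , (λ eq i → Inverse.inverseʳ (S↔T i) (eq i)) }

Fin-∏-inverse : ∀ {s} (σ : Fin s → ℕ) → Inverse (≡.setoid (Fin (∏ σ))) (Π-setoid (λ i → ≡.setoid (Fin (σ i))))
Fin-∏-inverse {zero} σ = record
  { to        = λ _ ()
  ; from      = λ _ → Fin.zero
  ; to-cong   = λ _ ()
  ; from-cong = λ _ → refl
  ; inverse   = (λ _ ()) , λ { {Fin.zero} _ → refl } }
Fin-∏-inverse {suc s} σ = record
  { to        = to
  ; from      = from
  ; to-cong   = λ { refl i → refl }
  ; from-cong = λ f≡g → cong₂ Fin.combine (f≡g Fin.zero) (Inverse.from-cong rest (f≡g ∘ Fin.suc))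
  ; inverse   = inverseˡ , inverseʳ }
  where
  rest = Fin-∏-inverse (σ ∘ Fin.suc)
  to : Fin (∏ σ) → ∀ i → Fin (σ i)
  to x Fin.zero    = proj₁ (Fin.remQuot {σ Fin.zero} (∏ (σ ∘ Fin.suc)) x)
  to x (Fin.suc i) = Inverse.to rest (proj₂ (Fin.remQuot {σ Fin.zero} (∏ (σ ∘ Fin.suc)) x)) i
  from : (∀ i → Fin (σ i)) → Fin (∏ σ)
  from f = Fin.combine (f Fin.zero) (Inverse.from rest (f ∘ Fin.suc))
  inverseˡ : ∀ {f x} → x ≡ from f → ∀ i → to x i ≡ f i
  inverseˡ {f} refl Fin.zero    = cong proj₁ (Finₚ.remQuot-combine {σ Fin.zero} {∏ (σ ∘ Fin.suc)} (f Fin.zero) _)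
  inverseˡ {f} refl (Fin.suc i) = trans (cong (λ r → Inverse.to rest r i)
                                            (cong proj₂ (Finₚ.remQuot-combine {σ Fin.zero} {∏ (σ ∘ Fin.suc)} (f Fin.zero) _)))
                                        (Inverse.inverseˡ rest refl i)
  inverseʳ : ∀ {x f} → (∀ i → f i ≡ to x i) → from f ≡ x
  inverseʳ {x} f≡ = trans (cong₂ Fin.combine (f≡ Fin.zero) (Inverse.inverseʳ rest (f≡ ∘ Fin.suc)))
                          (Finₚ.combine-remQuot {σ Fin.zero} (∏ (σ ∘ Fin.suc)) x)

module StabilisersOfBlocks {c ℓ} (K : ACField c ℓ) {m} (2≤m : 2 ≤ m) (G : Hypergraph m)
                          (cG : Connected G (whole G)) {x₀ y₀ : Fin (Hypergraph.n G)} (x₀≢y₀ : x₀ ≢ y₀)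
                          {s} (B : Fin s → Sub G) (B-injective : Injective _≡_ _≡_ B)
                          (B-block : ∀ b → IsBlock G (B b))
                          (B-all : ∀ X → IsBlock G X → ∃[ b ] (B b ≡ X)) where
  open ACField K renaming (refl to ≈-refl; sym to ≈-sym; trans to ≈-trans)
  open FieldProperties K
  open Hypergraph G
  open BlockTree 2≤m G cG x₀≢y₀ B B-injective B-block B-all
  open Stabilisers K G
  open Stabilising
  open import Relation.Binary.Reasoning.Setoid setoid
  open import Algebra.Solver.CommutativeMonoid *-commutativeMonoid using (solve; _⊜_; _⊕_)

  block-least : ∀ b → ∃ (IsLeast (verts (B b)))
  block-least b = least (proj₂ (block-vertex b))

  restrict : Stab G K (whole G) → (b : Fin s) → Stab G K (B b)
  restrict D b = normalise (proj₂ (block-least b)) (Stabilising-restrict (λ _ → ∈⊤) (λ _ → ∈⊤) (stabilising D))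

  module Glue (t : (b : Fin s) → Stab G K (B b)) where

    -- the new block is rescaled to agree with the earlier ones at its attaching vertex a
    glue : ∀ {L} → Ordering L → Fin n → Carrier
    glue [] v = 1#
    glue (attach o b _ a a∈b _ _) v with v ∈? verts (B b)
    ... | yes _ = glue o a * inv (d (t b) a) (nonzero (t b) a a∈b) * d (t b) v
    ... | no  _ = glue o v

    glue-≉0 : ∀ {L} (o : Ordering L) {v} → v ∈ W L → glue o v ≉0
    glue-≉0 [] _ = nontrivial
    glue-≉0 (attach {L} o b _ a a∈b a∈W _) {v} v∈W with v ∈? verts (B b)
    ... | yes v∈b = *-≉0 (*-≉0 (glue-≉0 o a∈W) (inv-≉0 _ _)) (nonzero (t b) v v∈b)
    ... | no  v∉b = glue-≉0 o (W-∪-old {L} v∈W v∉b)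

    glue-attach : ∀ {L} (o : Ordering L) b b∉L a a∈b a∈W (once : ∀ {w} → w ∈ verts (B b) → w ∈ W L → w ≡ a) →
                  ∀ {v} → v ∈ W L → glue (attach o b b∉L a a∈b a∈W once) v ≈ glue o v
    glue-attach o b b∉L a a∈b a∈W once {v} v∈W with v ∈? verts (B b)
    ... | no  _   = ≈-refl
    ... | yes v∈b with once v∈b v∈W
    ...   | refl = ≈-trans (*-assoc _ _ _) (≈-trans (*-congˡ (inv-correctˡ _ _)) (*-identityʳ _))

    glue-root : ∀ {L} (o : Ordering L) → glue o root ≈ 1#
    glue-root [] = ≈-refl
    glue-root (attach o b b∉L a a∈b a∈W once) =
      ≈-trans (glue-attach o b b∉L a a∈b a∈W once (x∈p∪q⁺ (inj₁ (x∈⁅x⁆ root)))) (glue-root o)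

    glue-on-block : ∀ {L} (o : Ordering L) {b} → b ∈ L →
                    ∃[ x ] (x ≉0 × ∀ {v} → v ∈ verts (B b) → glue o v ≈ x * d (t b) v)
    glue-on-block [] b∈⊥ = ⊥-elim (∉⊥ b∈⊥)
    glue-on-block (attach {L} o b b∉L a a∈b a∈W once) {c} c∈L′ with x∈p∪q⁻ L _ c∈L′
    ... | inj₁ c∈L = let x , x≉0 , on-c = glue-on-block o c∈L in
      x , x≉0 , λ v∈c → ≈-trans (glue-attach o b b∉L a a∈b a∈W once (∈W c∈L v∈c)) (on-c v∈c)
    ... | inj₂ c∈⁅b⁆ with x∈⁅y⁆⇒x≡y b c∈⁅b⁆
    ...   | refl = _ , *-≉0 (glue-≉0 o a∈W) (inv-≉0 _ _) , on-b
      where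
      on-b : ∀ {v} → v ∈ verts (B b) →
             glue (attach o b b∉L a a∈b a∈W once) v ≈ glue o a * inv (d (t b) a) (nonzero (t b) a a∈b) * d (t b) v
      on-b {v} v∈b with v ∈? verts (B b)
      ... | yes _   = ≈-refl
      ... | no  v∉b = contradiction v∈b v∉b

  open Glue

  glue-cong : ∀ t t′ → (∀ b i → i ∈ verts (B b) → d (t b) i ≈ d (t′ b) i) →
              ∀ {L} (o : Ordering L) {v} → v ∈ W L → glue t o v ≈ glue t′ o v
  glue-cong t t′ t≈t′ [] _ = ≈-refl
  glue-cong t t′ t≈t′ (attach {L} o b _ a a∈b a∈W _) {v} v∈W with v ∈? verts (B b)
  ... | yes v∈b = *-cong (*-cong (glue-cong t t′ t≈t′ o a∈W) (inv-cong _ _ (t≈t′ b a a∈b))) (t≈t′ b v v∈b)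
  ... | no  v∉b = glue-cong t t′ t≈t′ o (W-∪-old {L} v∈W v∉b)

  -- blocks that are rescalings of one global D glue back to D, by the normalisation at the root
  glue-rescaled : ∀ (D : Stab G K (whole G)) t → (∀ b → ∃[ κ ] ∀ {v} → v ∈ verts (B b) → d (t b) v ≈ κ * d D v) →
                  ∀ {L} (o : Ordering L) {v} → v ∈ W L → glue t o v ≈ d D v
  glue-rescaled D t rescaled [] v∈W with W-∅ (λ _ → ∉⊥) v∈W
  ... | refl = ≈-sym (first D root ∈⊤ (proj₂ root-least))
  glue-rescaled D t rescaled (attach {L} o b _ a a∈b a∈W _) {v} v∈W with v ∈? verts (B b)
  ... | no  v∉b = glue-rescaled D t rescaled o (W-∪-old {L} {b} v∈W v∉b)
  ... | yes v∈b = let κ , tb≈κD = rescaled b; y = d (t b) a; p = nonzero (t b) a a∈b in begin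
    glue t o a * inv y p * d (t b) v ≈⟨ *-cong (*-congʳ (glue-rescaled D t rescaled o a∈W)) (tb≈κD v∈b) ⟩
    d D a * inv y p * (κ * d D v)    ≈⟨ regroup _ _ _ _ ⟩
    (κ * d D a) * inv y p * d D v    ≈⟨ *-congʳ (*-congʳ (≈-sym (tb≈κD a∈b))) ⟩
    y * inv y p * d D v              ≈⟨ *-congʳ (inv-correct y p) ⟩
    1# * d D v                       ≈⟨ *-identityˡ _ ⟩
    d D v                            ∎
    where
    regroup : ∀ p q r s → p * q * (r * s) ≈ (r * p) * q * s
    regroup = solve 4 (λ p q r s → (p ⊕ q) ⊕ (r ⊕ s) ⊜ ((r ⊕ p) ⊕ q) ⊕ s) ≈-refl

  restrict-rescaled : ∀ D b → ∃[ κ ] ∀ {v} → v ∈ verts (B b) → d (restrict D b) v ≈ κ * d D v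
  restrict-rescaled D b = _ , λ _ → ≈-refl

  glued : ((b : Fin s) → Stab G K (B b)) → Stab G K (whole G)
  glued t = record
    { d       = glue t ordering
    ; nonzero = f≉0 st
    ; first   = λ i _ i-least → case least-unique (∈⊤ , i-least) root-least of λ { refl → glue-root t ordering }
    ; stab    = balanced st }
    where
    st : Stabilising (whole G) (glue t ordering)
    st = Stabilising-glue (λ i _ → glue-≉0 t ordering (W⊤ i)) λ j _ →
      let b , j∈b = edge-in-block j; x , x≉0 , on-b = glue-on-block t ordering {b} ∈⊤ in
      B b , j∈b , B-isSub b ,
      Stabilising-cong (λ v∈b → ≈-sym (on-b v∈b)) (Stabilising-scale x≉0 (stabilising (t b)))

  blocks-inverse : Inverse (Π-setoid (λ b → StabSetoid G K (B b))) (StabSetoid G K (whole G))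
  blocks-inverse = record
    { to        = glued
    ; from      = restrict
    ; to-cong   = λ {t} {t′} t≈t′ i _ → glue-cong t t′ t≈t′ ordering (W⊤ i)
    ; from-cong = λ {D} {D′} D≈D′ b i _ → let r = proj₁ (block-least b) in
        *-cong (inv-cong (nonzero D r ∈⊤) (nonzero D′ r ∈⊤) (D≈D′ r ∈⊤)) (D≈D′ i ∈⊤)
    ; inverse   = (λ {D} {t} → glued-restrict {D} {t}) , (λ {t} {D} → restrict-glued {t} {D}) }
    where
    glued-restrict : ∀ {D t} → (∀ b i → i ∈ verts (B b) → d (t b) i ≈ d (restrict D b) i) →
                     ∀ i → i ∈ ⊤ → d (glued t) i ≈ d D i
    glued-restrict {D} {t} t≈ i _ = glue-rescaled D t (λ b → _ , λ {v} v∈b → t≈ b v v∈b) ordering (W⊤ i)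

    restrict-glued : ∀ {t D} → (∀ i → i ∈ ⊤ → d D i ≈ d (glued t) i) →
                     ∀ b i → i ∈ verts (B b) → d (restrict D b) i ≈ d (t b) i
    restrict-glued {t} {D} D≈ b i i∈b = begin
      inv (d D r) (nonzero D r ∈⊤) * d D i ≈⟨ *-cong (inv-cong _ x≉0 Dr≈x) (≈-trans (D≈ i ∈⊤) (on-b i∈b)) ⟩
      inv x x≉0 * (x * d (t b) i)          ≈⟨ inv-cancelˡ x x≉0 _ ⟩
      d (t b) i                            ∎
      where
      r = proj₁ (block-least b)
      r-least = proj₂ (block-least b)
      on-block = glue-on-block t ordering {b} ∈⊤
      x = proj₁ on-block
      x≉0 = proj₁ (proj₂ on-block)
      on-b = proj₂ (proj₂ on-block)
      Dr≈x : d D r ≈ x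
      Dr≈x = begin
        d D r           ≈⟨ ≈-trans (D≈ r ∈⊤) (on-b (proj₁ r-least)) ⟩
        x * d (t b) r   ≈⟨ *-congˡ (first (t b) r (proj₁ r-least) (proj₂ r-least)) ⟩
        x * 1#          ≈⟨ *-identityʳ x ⟩
        x               ∎

theorem3p2 : {c ℓ : Level} (K : ACField c ℓ) (m : ℕ) → 2 ≤ m →
  (G : Hypergraph m) →
  Connected G (whole G) → HasCutVertex G (whole G) →
  (s : ℕ) → 2 ≤ s →
  (B : Fin s → Sub G) → Injective _≡_ _≡_ B →
  ((i : Fin s) → IsBlock G (B i)) →
  ((X : Sub G) → IsBlock G X → ∃[ i ] (B i ≡ X)) →
  (σ : Fin s → ℕ) → ((i : Fin s) → HasStabIndex G K (B i) (σ i)) →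
  HasStabIndex G K (whole G) (∏ σ)
theorem3p2 K m 2≤m G cG (u , (_ , V₁ , _ , _ , _ , 2≤∣V₁∣ , _)) s _ B B-injective B-block B-all σ s[Bᵢ]≡σᵢ =
  Composition.inverse (Fin-∏-inverse σ) (Composition.inverse (Π-inverse s[Bᵢ]≡σᵢ) blocks-inverse)
  where
  x₀≢y₀ = proj₁ (proj₂ (proj₂ (∃-two {p = V₁} 2≤∣V₁∣)))
  open StabilisersOfBlocks K 2≤m G cG x₀≢y₀ B B-injective B-block B-all
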